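{- Let $\mathcal{B}$ be a building set on $[n]$. Then $$f_{\mathcal{N}(\mathcal{B})}(t)\,(t+1)^{|\mathcal{B}_{\max}|}=\sum_{S\subseteq[n]}t^{|(\mathcal{B}|_S)_{\max}|}f_{\mathcal{N}(\mathcal{B}|_S)}(t),\qquad f_{\mathcal{P}(\mathcal{B})}(t)\,(t+1)^{|\mathcal{B}_{\max}|}=\sum_{S\subseteq[n]}f_{\mathcal{P}(\mathcal{B}|_S)}(t)\,t^{n-|S|}.$$
   Context: A building set on a finite set $X$ is a collection $\mathcal{B}$ of nonempty subsets of $X$ containing all singletons and such that $I\cup J\in\mathcal{B}$ whenever $I,J\in\mathcal{B}$, $I\cap J\neq\varnothing$; $\mathcal{B}_{\max}$ is its set of inclusion-maximal elements; $\mathcal{B}|_S=\{J\in\mathcal{B}:J\subseteq S\}$ (a building set on $S$, empty if $S=\varnothing$). A nested collection is a subset $N\subseteq\mathcal{B}\setminus\mathcal{B}_{\max}$ whose members are pairwise nested or disjoint and such that no union of $k\ge2$ pairwise disjoint members lies in $\mathcal{B}$. $f_{\mathcal{N}(\mathcal{B})}(t)=\sum_Nt^{|N|}$ over all nested collections $N$ (including $\varnothing$). The nestohedron $\mathcal{P}(\mathcal{B})$ is a simple polytope of dimension $d=|X|-|\mathcal{B}_{\max}|$ whose number $f_i$ of $i$-faces equals the number of nested collections of cardinality $d-i$, and $f_{\mathcal{P}(\mathcal{B})}(t)=\sum_{i=0}^df_it^i$; for $X=\varnothing$ it is a point. -}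

module Defs where

open import Data.Nat using (ℕ; zero; suc; _+_; _*_; _∸_; _≤ᵇ_)
open import Data.Bool using (Bool; true; false; T; not; _∧_; _∨_; if_then_else_)
open import Data.List using (List; []; _∷_; _++_; map; filter; length; foldr)
open import Data.Vec using (Vec; []; _∷_)
open import Data.Fin using (Fin)
open import Data.Fin.Subset using (Subset; ⁅_⁆; _∩_; _∪_; _⊆_; _⊂_; ∣_∣; Nonempty; ⊥; ⊤; inside; outside)
open import Data.Fin.Subset.Properties using (_⊆?_; _⊂?_; nonempty?)
open import Relation.Nullary using (does; ¬_)

Family : ℕ → Set
Family n = Subset n → Bool

_∈ᶠ_ : ∀ {n} → Subset n → Family n → Set
I ∈ᶠ B = T (B I)

record IsBuildingSet {n : ℕ} (B : Family n) : Set where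
  field
    nonempty  : ∀ I → I ∈ᶠ B → Nonempty I
    singleton : ∀ (i : Fin n) → ⁅ i ⁆ ∈ᶠ B
    union     : ∀ I J → I ∈ᶠ B → J ∈ᶠ B → Nonempty (I ∩ J) → (I ∪ J) ∈ᶠ B

allSubsets : (n : ℕ) → List (Subset n)
allSubsets zero    = [] ∷ []
allSubsets (suc n) = map (outside ∷_) (allSubsets n) ++ map (inside ∷_) (allSubsets n)

sublists : ∀ {A : Set} → List A → List (List A)
sublists []       = [] ∷ []
sublists (x ∷ xs) = sublists xs ++ map (x ∷_) (sublists xs)

_⊆ᵇ_ : ∀ {n} → Subset n → Subset n → Bool
I ⊆ᵇ J = does (I ⊆? J)

_⊂ᵇ_ : ∀ {n} → Subset n → Subset n → Bool
I ⊂ᵇ J = does (I ⊂? J)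

disjointᵇ : ∀ {n} → Subset n → Subset n → Bool
disjointᵇ I J = not (does (nonempty? (I ∩ J)))

allᵇ : ∀ {A : Set} → (A → Bool) → List A → Bool
allᵇ p = foldr (λ x acc → p x ∧ acc) true

allPairs : ∀ {A : Set} → (A → A → Bool) → List A → Bool
allPairs R []       = true
allPairs R (x ∷ xs) = allᵇ (R x) xs ∧ allPairs R xs

⋃ : ∀ {n} → List (Subset n) → Subset n
⋃ = foldr _∪_ ⊥

count : ∀ {A : Set} → (A → Bool) → List A → ℕ
count p xs = length (filter (λ x → T? (p x)) xs)
  where open import Data.Bool.Properties using (T?)

isMaxᵇ : ∀ {n} → Family n → Subset n → Bool
isMaxᵇ {n} B I = B I ∧ allᵇ (λ J → not (B J ∧ (I ⊂ᵇ J))) (allSubsets n)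

numMax : ∀ {n} → Family n → ℕ
numMax {n} B = count (isMaxᵇ B) (allSubsets n)

restrict : ∀ {n} → Family n → Subset n → Family n
restrict B S J = B J ∧ (J ⊆ᵇ S)

nonMax : ∀ {n} → Family n → List (Subset n)
nonMax {n} B = filter (λ I → Data.Bool.Properties.T? (B I ∧ not (isMaxᵇ B I))) (allSubsets n)
  where import Data.Bool.Properties

nestedOrDisjointᵇ : ∀ {n} → Subset n → Subset n → Bool
nestedOrDisjointᵇ I J = (I ⊆ᵇ J) ∨ (J ⊆ᵇ I) ∨ disjointᵇ I J

isNestedᵇ : ∀ {n} → Family n → List (Subset n) → Bool
isNestedᵇ B N =
  allPairs nestedOrDisjointᵇ N ∧
  allᵇ (λ M → not ((2 ≤ᵇ length M) ∧ allPairs disjointᵇ M ∧ B (⋃ M))) (sublists N)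

nestedCollections : ∀ {n} → Family n → List (List (Subset n))
nestedCollections B = filter (λ N → Data.Bool.Properties.T? (isNestedᵇ B N)) (sublists (nonMax B))
  where import Data.Bool.Properties

numNested : ∀ {n} → Family n → ℕ → ℕ
numNested B k = count (λ N → length N Data.Nat.≡ᵇ k) (nestedCollections B)
  where import Data.Nat

Poly : Set
Poly = ℕ → ℕ

_≈ₚ_ : Poly → Poly → Set
p ≈ₚ q = ∀ k → p k ≡ q k
  where open import Relation.Binary.PropositionalEquality using (_≡_)

0ₚ : Poly
0ₚ _ = 0

_+ₚ_ : Poly → Poly → Poly
(p +ₚ q) k = p k + q k

sumTo : ℕ → (ℕ → ℕ) → ℕ
sumTo zero    f = f 0
sumTo (suc k) f = sumTo k f + f (suc k)

_*ₚ_ : Poly → Poly → Poly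
(p *ₚ q) k = sumTo k (λ i → p i * q (k ∸ i))

tpow : ℕ → Poly
tpow m k = if m Data.Nat.≡ᵇ k then 1 else 0
  where import Data.Nat

1ₚ : Poly
1ₚ = tpow 0

t+1 : Poly
t+1 = tpow 1 +ₚ tpow 0

_^ₚ_ : Poly → ℕ → Poly
p ^ₚ zero  = 1ₚ
p ^ₚ suc m = p *ₚ (p ^ₚ m)

Σₚ : ∀ {A : Set} → List A → (A → Poly) → Poly
Σₚ xs f = foldr (λ x acc → f x +ₚ acc) 0ₚ xs

fN : ∀ {n} → Family n → Poly
fN B k = numNested B k

fP : ∀ {n} → Family n → Subset n → Poly
fP B S i = if i ≤ᵇ d then numNested B (d ∸ i) else 0
  where d = ∣ S ∣ ∸ numMax B

-- For a weight ℓ : ℕ → ℕ let Σ_N ℓ (|N|) range over the nested collections N of B.  The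
-- coefficients of f_N(B) and f_P(B) are such sums for the weights a ↦ [a = k] and [a + i = d],
-- and multiplying by (1 + t)^m replaces ℓ by a ↦ Σⱼ (m choose j) ℓ (a + j).  As a maximal
-- element of B may be added to or removed from any nested collection, the multiplied sum
-- counts, with weight ℓ, the nested lists of arbitrary members of B.  Grouped by their union S,
-- the lists with union S are exactly the nested collections of B|_S together with all of
-- (B|_S)_max, whence the factor t^|(B|_S)_max|.  For f_P one also needs the dimension bound
-- |N| ≤ |⋃ N|: a topmost member of N has a point outside all the other members.

module Submission where

open import Algebra.Properties.CommutativeSemigroup using (interchange)
open import Data.Bool using (Bool; true; false; T; not; _∧_; _∨_; if_then_else_)
import Data.Bool as Bool
open import Data.Bool.Properties using (T?; T-∧; T-∨; ∧-identityʳ)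
open import Data.Empty using (⊥-elim)
open import Data.Fin.Properties using (any?)
open import Data.Fin.Subset
  using (Subset; inside; outside; _∈_; _∉_; _⊆_; _⊂_; _∪_; _∩_; ⊥; ⊤; ⁅_⁆; Nonempty; ∣_∣)
open import Data.Fin.Subset.Properties
  using (x∈p∪q⁻; x∈p∪q⁺; x∈p∩q⁺; x∈⁅x⁆; x∈⁅y⁆⇒x≡y; ∉⊥; ⊆⊤; ⊆-antisym; ⊆-trans; p⊆p∪q; q⊆p∪q;
         ∪-identityʳ; ∩-comm; ∣p∣≤n; ∣⊤∣≡n; p⊂q⇒∣p∣<∣q∣; _∈?_; _⊆?_; _⊂?_; nonempty?)
open import Data.List using (List; []; _∷_; _++_; map; length; filter; filterᵇ)
open import Data.List.Membership.Propositional using (find) renaming (_∈_ to _∈ˡ_)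
open import Data.List.Membership.Propositional.Properties
  using (∈-map⁺; ∈-map⁻; ∈-++⁺ˡ; ∈-++⁺ʳ; ∈-++⁻; ∈-filter⁺; ∈-filter⁻)
open import Data.List.Relation.Binary.Sublist.Propositional
  using ([]; _∷_; _∷ʳ_; minimum) renaming (_⊆_ to _⊑_; ⊆-refl to ⊑-refl; ⊆-trans to ⊑-trans)
open import Data.List.Relation.Binary.Sublist.Propositional.Properties using (++⁺; All-resp-⊆; Any-resp-⊆; filter-⊆)
open import Data.List.Relation.Unary.All as All using (All; []; _∷_)
import Data.List.Relation.Unary.All.Properties as All
open import Data.List.Relation.Unary.All.Properties using (All¬⇒¬Any; ¬Any⇒All¬; ¬All⇒Any¬)
open import Data.List.Relation.Unary.AllPairs as AllPairs using (AllPairs; []; _∷_)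
open import Data.List.Relation.Unary.Any using (here; there; _─_)
open import Data.List.Relation.Unary.Unique.Propositional using (Unique)
import Data.List.Relation.Unary.Unique.Propositional.Properties as Unique
open import Data.Nat using (ℕ; zero; suc; _+_; _*_; _∸_; _≤_; _<_; z≤n; s≤s; _≡ᵇ_; _≤ᵇ_; _<ᵇ_)
open import Data.Nat.Properties
open import Data.Nat.Tactic.RingSolver using (solve-∀)
open import Data.Product using (_×_; _,_; proj₁; proj₂; ∃)
import Data.Product as Product
open import Data.Sum using (_⊎_; inj₁; inj₂)
import Data.Sum as Sum
open import Data.Unit using (tt)
open import Data.Vec using ([]; _∷_; head)
open import Data.Vec.Properties using (≡-dec; ∷-injectiveʳ)
open import Function using (_∘_; id; flip)
open import Function.Bundles using (module Equivalence)
open Equivalence using (to; from)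
open import Relation.Binary using (DecidableEquality)
open import Relation.Binary.PropositionalEquality
open import Relation.Nullary using (Dec; yes; no; does; ¬_)
open import Relation.Nullary.Decidable using (dec-true; dec-false; _×-dec_; ¬?; decidable-stable)
import Relation.Unary
open import Defs

+-interchange : ∀ a b c d → (a + b) + (c + d) ≡ (a + c) + (b + d)
+-interchange = interchange +-commutativeSemigroup

T-ext : ∀ {a b} → (T a → T b) → (T b → T a) → a ≡ b
T-ext {false} {false} _ _ = refl
T-ext {false} {true}  _ g = ⊥-elim (g tt)
T-ext {true}  {false} f _ = ⊥-elim (f tt)
T-ext {true}  {true}  _ _ = refl

+-swapʳ : ∀ a b c → a + b + c ≡ a + c + b
+-swapʳ = solve-∀

+-rearrange : ∀ a b c → a + b + c ≡ b + (a + c)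
+-rearrange = solve-∀

𝟙 : Bool → ℕ
𝟙 b = if b then 1 else 0

does⇒ : ∀ {p} {P : Set p} (d : Dec P) → T (does d) → P
does⇒ (yes p) _ = p

does⇐ : ∀ {p} {P : Set p} (d : Dec P) → P → T (does d)
does⇐ (yes _) _ = tt
does⇐ (no ¬p) p = ¬p p

does⇒¬ : ∀ {p} {P : Set p} (d : Dec P) → T (not (does d)) → ¬ P
does⇒¬ (no ¬p) _ = ¬p

¬⇒does : ∀ {p} {P : Set p} (d : Dec P) → ¬ P → T (not (does d))
¬⇒does (yes p) ¬p = ¬p p
¬⇒does (no _)  _  = tt

T-not⇒¬ : ∀ {b} → T (not b) → ¬ T b
T-not⇒¬ {false} _ ()

¬⇒T-not : ∀ {b} → ¬ T b → T (not b)
¬⇒T-not {false} _ = tt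
¬⇒T-not {true}  ¬t = ¬t tt

T-implies⁺ : ∀ {b c} → (T b → T c) → T (not b ∨ c)
T-implies⁺ {false} _ = tt
T-implies⁺ {true}  h = h tt

T-implies⁻ : ∀ {b c} → T (not b ∨ c) → T b → T c
T-implies⁻ {true} t _ = t

module _ {A : Set} {p : A → Bool} where

  T-allᵇ⁺ : ∀ {xs} → All (T ∘ p) xs → T (allᵇ p xs)
  T-allᵇ⁺ []         = tt
  T-allᵇ⁺ (px ∷ pxs) = from T-∧ (px , T-allᵇ⁺ pxs)

  T-allᵇ⁻ : ∀ xs → T (allᵇ p xs) → All (T ∘ p) xs
  T-allᵇ⁻ []       _ = []
  T-allᵇ⁻ (x ∷ xs) t = proj₁ (to T-∧ t) ∷ T-allᵇ⁻ xs (proj₂ (to T-∧ t))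

∈-∷⁻ : ∀ {A : Set} {x y : A} {N} → y ∈ˡ x ∷ N → ¬ x ≡ y → y ∈ˡ N
∈-∷⁻ (here refl) x≢y = ⊥-elim (x≢y refl)
∈-∷⁻ (there m)   _   = m

module _ {A : Set} {R : A → A → Bool} where

  T-allPairs⁺ : ∀ {xs} → AllPairs (λ x y → T (R x y)) xs → T (allPairs R xs)
  T-allPairs⁺ []         = tt
  T-allPairs⁺ (rx ∷ rxs) = from T-∧ (T-allᵇ⁺ rx , T-allPairs⁺ rxs)

  T-allPairs⁻ : ∀ xs → T (allPairs R xs) → AllPairs (λ x y → T (R x y)) xs
  T-allPairs⁻ []       _ = []
  T-allPairs⁻ (x ∷ xs) t = T-allᵇ⁻ xs (proj₁ (to T-∧ t)) ∷ T-allPairs⁻ xs (proj₂ (to (T-∧ {allᵇ (R x) xs}) t))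

𝟙-≡ᵇ-refl : ∀ m → 𝟙 (m ≡ᵇ m) ≡ 1
𝟙-≡ᵇ-refl zero    = refl
𝟙-≡ᵇ-refl (suc m) = 𝟙-≡ᵇ-refl m

𝟙-≡ᵇ-≢ : ∀ {m n} → ¬ m ≡ n → 𝟙 (m ≡ᵇ n) ≡ 0
𝟙-≡ᵇ-≢ {m} {n} m≢n with m ≡ᵇ n in e
... | true  = ⊥-elim (m≢n (≡ᵇ⇒≡ m n (subst T (sym e) tt)))
... | false = refl

𝟙-≡ᵇ-cong : ∀ {a b c d} → (a ≡ b → c ≡ d) → (c ≡ d → a ≡ b) → 𝟙 (a ≡ᵇ b) ≡ 𝟙 (c ≡ᵇ d)
𝟙-≡ᵇ-cong {a} {b} {c} {d} f g =
  cong 𝟙 (T-ext (≡⇒≡ᵇ c d ∘ f ∘ ≡ᵇ⇒≡ a b) (≡⇒≡ᵇ a b ∘ g ∘ ≡ᵇ⇒≡ c d))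

-- Sums over lists and sublists

module _ {A : Set} where

  sumOver : List A → (A → ℕ) → ℕ
  sumOver []       f = 0
  sumOver (x ∷ xs) f = f x + sumOver xs f

  sumOver-++ : ∀ xs ys (f : A → ℕ) → sumOver (xs ++ ys) f ≡ sumOver xs f + sumOver ys f
  sumOver-++ []       ys f = refl
  sumOver-++ (x ∷ xs) ys f = trans (cong (f x +_) (sumOver-++ xs ys f)) (sym (+-assoc (f x) _ _))

  sumOver-congᴬ : ∀ {xs} {f g : A → ℕ} → All (λ x → f x ≡ g x) xs → sumOver xs f ≡ sumOver xs g
  sumOver-congᴬ []       = refl
  sumOver-congᴬ (e ∷ es) = cong₂ _+_ e (sumOver-congᴬ es)

  sumOver-cong : ∀ xs {f g : A → ℕ} → (∀ x → f x ≡ g x) → sumOver xs f ≡ sumOver xs g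
  sumOver-cong xs h = sumOver-congᴬ (All.tabulate {xs = xs} (λ {x} _ → h x))

  sumOver-+ : ∀ xs (f g : A → ℕ) → sumOver xs (λ x → f x + g x) ≡ sumOver xs f + sumOver xs g
  sumOver-+ []       f g = refl
  sumOver-+ (x ∷ xs) f g =
    trans (cong (f x + g x +_) (sumOver-+ xs f g)) (+-interchange (f x) (g x) _ _)

  sumOver-zero : ∀ xs → sumOver xs (λ _ → 0) ≡ 0
  sumOver-zero []       = refl
  sumOver-zero (x ∷ xs) = sumOver-zero xs

sumOver-map : ∀ {A B : Set} (g : A → B) xs (f : B → ℕ) → sumOver (map g xs) f ≡ sumOver xs (f ∘ g)
sumOver-map g []       f = refl
sumOver-map g (x ∷ xs) f = cong (f (g x) +_) (sumOver-map g xs f)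

module _ {A : Set} where

  filterᵇ-filterᵇ : ∀ (p q : A → Bool) xs → filterᵇ p (filterᵇ q xs) ≡ filterᵇ (λ x → q x ∧ p x) xs
  filterᵇ-filterᵇ p q []       = refl
  filterᵇ-filterᵇ p q (x ∷ xs) with q x
  ... | false = filterᵇ-filterᵇ p q xs
  ... | true  with p x
  ...   | false = filterᵇ-filterᵇ p q xs
  ...   | true  = cong (x ∷_) (filterᵇ-filterᵇ p q xs)

  count-filterᵇ : ∀ (p q : A → Bool) xs → count p (filterᵇ q xs) ≡ sumOver xs (λ x → if q x then 𝟙 (p x) else 0)
  count-filterᵇ p q []       = refl
  count-filterᵇ p q (x ∷ xs) with q x
  ... | false = count-filterᵇ p q xs
  ... | true  with p x
  ...   | false = count-filterᵇ p q xs
  ...   | true  = cong suc (count-filterᵇ p q xs)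

  count-filterᵇ-⇒ : ∀ (p q : A → Bool) xs → (∀ {x} → T (p x) → T (q x)) → count p (filterᵇ q xs) ≡ count p xs
  count-filterᵇ-⇒ p q []       _   = refl
  count-filterᵇ-⇒ p q (x ∷ xs) p⇒q with q x in e
  ... | true  with p x
  ...   | false = count-filterᵇ-⇒ p q xs p⇒q
  ...   | true  = cong suc (count-filterᵇ-⇒ p q xs p⇒q)
  count-filterᵇ-⇒ p q (x ∷ xs) p⇒q | false with p x in e′
  ...   | false = count-filterᵇ-⇒ p q xs p⇒q
  ...   | true  = ⊥-elim (subst T e (p⇒q (subst T (sym e′) tt)))

module _ {A : Set} where

  ∈-sublists⁺ : ∀ {N L : List A} → N ⊑ L → N ∈ˡ sublists L
  ∈-sublists⁺ []         = here refl
  ∈-sublists⁺ (y ∷ʳ s)   = ∈-++⁺ˡ (∈-sublists⁺ s)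
  ∈-sublists⁺ {L = x ∷ L} (refl ∷ s) = ∈-++⁺ʳ (sublists L) (∈-map⁺ (x ∷_) (∈-sublists⁺ s))

  ∈-sublists⁻ : ∀ {N : List A} L → N ∈ˡ sublists L → N ⊑ L
  ∈-sublists⁻ []      (here refl) = []
  ∈-sublists⁻ (x ∷ L) m with ∈-++⁻ (sublists L) m
  ... | inj₁ m′ = x ∷ʳ ∈-sublists⁻ L m′
  ... | inj₂ m′ with ∈-map⁻ (x ∷_) m′
  ...   | N′ , m″ , refl = refl ∷ ∈-sublists⁻ L m″

  all-sublists⁺ : ∀ {Q : List A → Set} L → (∀ {N} → N ⊑ L → Q N) → All Q (sublists L)
  all-sublists⁺ L h = All.tabulate (λ m → h (∈-sublists⁻ L m))

  all-sublists⁻ : ∀ {Q : List A → Set} {L N} → All Q (sublists L) → N ⊑ L → Q N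
  all-sublists⁻ a s = All.lookup a (∈-sublists⁺ s)

module _ {A : Set} where

  AllPairs-strengthen : ∀ {P : A → Set} {R S : A → A → Set} →
    (∀ {x y} → P x → P y → R x y → S x y) → ∀ {xs} → All P xs → AllPairs R xs → AllPairs S xs
  AllPairs-strengthen f []         []         = []
  AllPairs-strengthen f (px ∷ pxs) (rx ∷ rxs) =
    All.zipWith (λ (py , r) → f px py r) (pxs , rx) ∷ AllPairs-strengthen f pxs rxs

  AllPairs-≢ : ∀ {R : A → A → Set} {xs x y} → AllPairs R xs → x ∈ˡ xs → y ∈ˡ xs → ¬ x ≡ y → R x y ⊎ R y x
  AllPairs-≢ (r ∷ _)  (here refl) (here refl) x≢y = ⊥-elim (x≢y refl)
  AllPairs-≢ (r ∷ _)  (here refl) (there y∈) _   = inj₁ (All.lookup r y∈)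
  AllPairs-≢ (r ∷ _)  (there x∈)  (here refl) _  = inj₂ (All.lookup r x∈)
  AllPairs-≢ (_ ∷ rs) (there x∈)  (there y∈) x≢y = AllPairs-≢ rs x∈ y∈ x≢y

  ─-⊑ : ∀ {x : A} xs (x∈ : x ∈ˡ xs) → (xs ─ x∈) ⊑ xs
  ─-⊑ (y ∷ xs) (here _)  = y ∷ʳ ⊑-refl
  ─-⊑ (y ∷ xs) (there p) = refl ∷ ─-⊑ xs p

  length-─ : ∀ {x : A} xs (x∈ : x ∈ˡ xs) → length xs ≡ suc (length (xs ─ x∈))
  length-─ (y ∷ xs) (here _)  = refl
  length-─ (y ∷ xs) (there p) = cong suc (length-─ xs p)

  unique-─ : ∀ {x : A} xs (x∈ : x ∈ˡ xs) → Unique xs → ¬ x ∈ˡ (xs ─ x∈)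
  unique-─ (y ∷ xs) (here refl) (y∉ ∷ _) = All¬⇒¬Any y∉
  unique-─ (y ∷ xs) (there p)   (y∉ ∷ u) (here refl) = All¬⇒¬Any y∉ p
  unique-─ (y ∷ xs) (there p)   (_ ∷ u)  (there q)   = unique-─ xs p u q

  AllPairs-resp-⊑ : ∀ {R : A → A → Set} {xs ys} → xs ⊑ ys → AllPairs R ys → AllPairs R xs
  AllPairs-resp-⊑ []         []       = []
  AllPairs-resp-⊑ (y ∷ʳ s)   (_ ∷ rs) = AllPairs-resp-⊑ s rs
  AllPairs-resp-⊑ (refl ∷ s) (r ∷ rs) = All-resp-⊆ s r ∷ AllPairs-resp-⊑ s rs

module _ {A : Set} (_≟_ : DecidableEquality A) where

  sumOver-≟-∉ : ∀ {x} xs c → ¬ x ∈ˡ xs → sumOver xs (λ y → if does (x ≟ y) then c else 0) ≡ 0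
  sumOver-≟-∉ {x} xs c x∉xs =
    trans (sumOver-congᴬ (All.map (λ x≢y → cong (if_then c else 0) (dec-false (x ≟ _) x≢y)) (¬Any⇒All¬ xs x∉xs)))
          (sumOver-zero xs)

  sumOver-≟ : ∀ {x xs} c → Unique xs → x ∈ˡ xs → sumOver xs (λ y → if does (x ≟ y) then c else 0) ≡ c
  sumOver-≟ {x} {y ∷ ys} c (y∉ys ∷ _) (here refl) =
    trans (cong₂ _+_ (cong (if_then c else 0) (dec-true (x ≟ x) refl)) (sumOver-≟-∉ ys c (All¬⇒¬Any y∉ys)))
          (+-identityʳ c)
  sumOver-≟ {x} {y ∷ ys} c (y∉ys ∷ u) (there x∈ys) =
    cong₂ _+_ (cong (if_then c else 0) (dec-false (x ≟ y) (λ where refl → All¬⇒¬Any y∉ys x∈ys)))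
              (sumOver-≟ c u x∈ys)

module _ {A : Set} where

  weight : (List A → Bool) → (ℕ → ℕ) → List A → ℕ
  weight P ℓ N = if P N then ℓ (length N) else 0

  sublistSum : List A → (List A → Bool) → (ℕ → ℕ) → ℕ
  sublistSum []      P ℓ = weight P ℓ []
  sublistSum (x ∷ L) P ℓ = sublistSum L P ℓ + sublistSum L (P ∘ (x ∷_)) (ℓ ∘ suc)

  sublistSum-sublists : ∀ L P ℓ → sublistSum L P ℓ ≡ sumOver (sublists L) (weight P ℓ)
  sublistSum-sublists []      P ℓ = sym (+-identityʳ _)
  sublistSum-sublists (x ∷ L) P ℓ = begin
      sublistSum L P ℓ + sublistSum L (P ∘ (x ∷_)) (ℓ ∘ suc)
    ≡⟨ cong₂ _+_ (sublistSum-sublists L P ℓ) (sublistSum-sublists L (P ∘ (x ∷_)) (ℓ ∘ suc)) ⟩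
      sumOver (sublists L) (weight P ℓ) + sumOver (sublists L) (weight P ℓ ∘ (x ∷_))
    ≡⟨ cong (sumOver (sublists L) (weight P ℓ) +_) (sumOver-map (x ∷_) (sublists L) (weight P ℓ)) ⟨
      sumOver (sublists L) (weight P ℓ) + sumOver (map (x ∷_) (sublists L)) (weight P ℓ)
    ≡⟨ sumOver-++ (sublists L) _ (weight P ℓ) ⟨
      sumOver (sublists (x ∷ L)) (weight P ℓ)
    ∎
    where open ≡-Reasoning

  sublistSum-cong : ∀ L {P₁ P₂ ℓ₁ ℓ₂} → (∀ {N} → N ⊑ L → weight P₁ ℓ₁ N ≡ weight P₂ ℓ₂ N) →
    sublistSum L P₁ ℓ₁ ≡ sublistSum L P₂ ℓ₂
  sublistSum-cong []      h = h []
  sublistSum-cong (x ∷ L) h = cong₂ _+_ (sublistSum-cong L (h ∘ (x ∷ʳ_))) (sublistSum-cong L (h ∘ (refl ∷_)))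

  sublistSum-congᴾ : ∀ L {P₁ P₂} ℓ → (∀ {N} → N ⊑ L → P₁ N ≡ P₂ N) →
    sublistSum L P₁ ℓ ≡ sublistSum L P₂ ℓ
  sublistSum-congᴾ L ℓ h = sublistSum-cong L (λ {N} s → cong (λ b → if b then ℓ (length N) else 0) (h s))

  sublistSum-congʷ : ∀ L P {ℓ₁ ℓ₂} → (∀ {N} → N ⊑ L → T (P N) → ℓ₁ (length N) ≡ ℓ₂ (length N)) →
    sublistSum L P ℓ₁ ≡ sublistSum L P ℓ₂
  sublistSum-congʷ L P {ℓ₁} {ℓ₂} h = sublistSum-cong L (λ {N} s → congʷ {ℓ₁} {ℓ₂} N (h s))
    where
    congʷ : ∀ {ℓ₁ ℓ₂} N → (T (P N) → ℓ₁ (length N) ≡ ℓ₂ (length N)) → weight P ℓ₁ N ≡ weight P ℓ₂ N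
    congʷ N h with P N
    ... | true  = h tt
    ... | false = refl

  sublistSum-+ : ∀ L P (ℓ₁ ℓ₂ : ℕ → ℕ) →
    sublistSum L P (λ a → ℓ₁ a + ℓ₂ a) ≡ sublistSum L P ℓ₁ + sublistSum L P ℓ₂
  sublistSum-+ []      P ℓ₁ ℓ₂ with P []
  ... | true  = refl
  ... | false = refl
  sublistSum-+ (x ∷ L) P ℓ₁ ℓ₂ =
    trans (cong₂ _+_ (sublistSum-+ L P ℓ₁ ℓ₂) (sublistSum-+ L (P ∘ (x ∷_)) (ℓ₁ ∘ suc) (ℓ₂ ∘ suc)))
          (+-interchange (sublistSum L P ℓ₁) (sublistSum L P ℓ₂) _ _)

  sublistSum-zero : ∀ L P ℓ → (∀ {N} → N ⊑ L → T (P N) → ℓ (length N) ≡ 0) → sublistSum L P ℓ ≡ 0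
  sublistSum-zero []      P ℓ h with P [] in e
  ... | true  = h [] (subst T (sym e) tt)
  ... | false = refl
  sublistSum-zero (x ∷ L) P ℓ h =
    cong₂ _+_ (sublistSum-zero L P ℓ (h ∘ (x ∷ʳ_))) (sublistSum-zero L (P ∘ (x ∷_)) (ℓ ∘ suc) (h ∘ (refl ∷_)))

  sublistSum≡0⇒ : ∀ L P ℓ → sublistSum L P ℓ ≡ 0 → ∀ {N} → N ⊑ L → T (P N) → ℓ (length N) ≡ 0
  sublistSum≡0⇒ []      P ℓ e [] t with P [] | t
  ... | true | _ = e
  sublistSum≡0⇒ (x ∷ L) P ℓ e (.x ∷ʳ s) t = sublistSum≡0⇒ L P ℓ (m+n≡0⇒m≡0 _ e) s t
  sublistSum≡0⇒ (x ∷ L) P ℓ e (refl ∷ s) t = sublistSum≡0⇒ L (P ∘ (x ∷_)) (ℓ ∘ suc) (m+n≡0⇒n≡0 _ e) s t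

  sublistSum-filter : ∀ (r : A → Bool) L P ℓ → (∀ {N} → T (P N) → All (T ∘ r) N) →
    sublistSum L P ℓ ≡ sublistSum (filterᵇ r L) P ℓ
  sublistSum-filter r []      P ℓ h = refl
  sublistSum-filter r (x ∷ L) P ℓ h with r x in e
  ... | true  = cong₂ _+_ (sublistSum-filter r L P ℓ h)
                          (sublistSum-filter r L (P ∘ (x ∷_)) (ℓ ∘ suc) (All.tail ∘ h))
  ... | false = trans (cong₂ _+_ (sublistSum-filter r L P ℓ h) (sublistSum-zero L (P ∘ (x ∷_)) (ℓ ∘ suc) x∉))
                      (+-identityʳ _)
    where
    x∉ : ∀ {N} → N ⊑ L → T (P (x ∷ N)) → ℓ (suc (length N)) ≡ 0
    x∉ _ t = ⊥-elim (subst T e (All.head (h t)))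

-- stepSum m ℓ a = Σⱼ (m choose j) ℓ (a + j): the weight dual to multiplication by (1 + t)^m.
stepSum : ℕ → (ℕ → ℕ) → ℕ → ℕ
stepSum zero    ℓ = ℓ
stepSum (suc m) ℓ = stepSum m (λ a → ℓ a + ℓ (suc a))

stepSum-cong : ∀ m {ℓ₁ ℓ₂ : ℕ → ℕ} → (∀ a → ℓ₁ a ≡ ℓ₂ a) → ∀ a → stepSum m ℓ₁ a ≡ stepSum m ℓ₂ a
stepSum-cong zero    h = h
stepSum-cong (suc m) h = stepSum-cong m (λ b → cong₂ _+_ (h b) (h (suc b)))

stepSum-+ : ∀ m (ℓ₁ ℓ₂ : ℕ → ℕ) a → stepSum m (λ b → ℓ₁ b + ℓ₂ b) a ≡ stepSum m ℓ₁ a + stepSum m ℓ₂ a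
stepSum-+ zero    ℓ₁ ℓ₂ a = refl
stepSum-+ (suc m) ℓ₁ ℓ₂ a =
  trans (stepSum-cong m (λ b → +-interchange (ℓ₁ b) (ℓ₂ b) (ℓ₁ (suc b)) (ℓ₂ (suc b))) a) (stepSum-+ m _ _ a)

stepSum-suc : ∀ m (ℓ : ℕ → ℕ) a → stepSum m (ℓ ∘ suc) a ≡ stepSum m ℓ (suc a)
stepSum-suc zero    ℓ a = refl
stepSum-suc (suc m) ℓ a = stepSum-suc m (λ b → ℓ b + ℓ (suc b)) a

stepSum-≥ : ∀ m (ℓ : ℕ → ℕ) a → ℓ (m + a) ≤ stepSum m ℓ a
stepSum-≥ zero    ℓ a = ≤-refl
stepSum-≥ (suc m) ℓ a = ≤-trans (m≤n+m _ (ℓ (m + a))) (stepSum-≥ m (λ b → ℓ b + ℓ (suc b)) a)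

stepSum-vanishes : ∀ m (ℓ : ℕ → ℕ) a → (∀ j → j ≤ m → ℓ (a + j) ≡ 0) → stepSum m ℓ a ≡ 0
stepSum-vanishes zero    ℓ a h = trans (cong ℓ (sym (+-identityʳ a))) (h 0 z≤n)
stepSum-vanishes (suc m) ℓ a h = stepSum-vanishes m _ a λ j j≤m →
  cong₂ _+_ (h j (m≤n⇒m≤1+n j≤m)) (trans (cong ℓ (sym (+-suc a j))) (h (suc j) (s≤s j≤m)))

module Marked {A : Set} (_≟_ : DecidableEquality A) (marked : A → Bool) (Good : A → Set) where

  open import Data.List.Membership.DecPropositional _≟_ using () renaming (_∈?_ to _∈ˡ?_)

  unmarked : List A → List A
  unmarked = filterᵇ (not ∘ marked)

  containsMarked : List A → List A → Bool
  containsMarked L N = allᵇ (λ y → not (marked y) ∨ does (y ∈ˡ? N)) L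

  IgnoresMarked : (List A → Bool) → Set
  IgnoresMarked P = ∀ N₁ N₂ y → T (marked y) → All Good N₁ → All Good N₂ →
                    P (N₁ ++ y ∷ N₂) ≡ P (N₁ ++ N₂)

  ignoresMarked-∷ : ∀ {P} x → Good x → IgnoresMarked P → IgnoresMarked (P ∘ (x ∷_))
  ignoresMarked-∷ x gx ign N₁ N₂ y my g₁ = ign (x ∷ N₁) N₂ y my (gx ∷ g₁)

  containsMarked⁺ : ∀ L {N} → All (λ y → T (marked y) → y ∈ˡ N) L → T (containsMarked L N)
  containsMarked⁺ L {N} = T-allᵇ⁺ ∘ All.map (λ {y} h → T-implies⁺ (does⇐ (y ∈ˡ? N) ∘ h))

  containsMarked⁻ : ∀ L {N} → T (containsMarked L N) → All (λ y → T (marked y) → y ∈ˡ N) L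
  containsMarked⁻ L {N} = All.map (λ {y} t → does⇒ (y ∈ˡ? N) ∘ T-implies⁻ t) ∘ T-allᵇ⁻ L

  sublistSum-ignoresMarked : ∀ L P ℓ → All Good L → IgnoresMarked P →
    sublistSum L P ℓ ≡ sublistSum (unmarked L) P (stepSum (count marked L) ℓ)
  sublistSum-ignoresMarked []      P ℓ _          _   = refl
  sublistSum-ignoresMarked (x ∷ L) P ℓ (gx ∷ gL) ign with marked x in e
  ... | true  = begin
      sublistSum (x ∷ L) P ℓ
    ≡⟨⟩
      sublistSum L P ℓ + sublistSum L (P ∘ (x ∷_)) (ℓ ∘ suc)
    ≡⟨ cong (sublistSum L P ℓ +_) (sublistSum-congᴾ L (ℓ ∘ suc) drop-x) ⟩
      sublistSum L P ℓ + sublistSum L P (ℓ ∘ suc)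
    ≡⟨ sublistSum-+ L P ℓ (ℓ ∘ suc) ⟨
      sublistSum L P (λ a → ℓ a + ℓ (suc a))
    ≡⟨ sublistSum-ignoresMarked L P _ gL ign ⟩
      sublistSum (unmarked L) P (stepSum (suc (count marked L)) ℓ)
    ∎
    where
    open ≡-Reasoning
    drop-x : ∀ {N} → N ⊑ L → P (x ∷ N) ≡ P N
    drop-x s = ign [] _ x (subst T (sym e) tt) [] (All-resp-⊆ s gL)
  ... | false = begin
      sublistSum (x ∷ L) P ℓ
    ≡⟨⟩
      sublistSum L P ℓ + sublistSum L (P ∘ (x ∷_)) (ℓ ∘ suc)
    ≡⟨ cong₂ _+_ (sublistSum-ignoresMarked L P ℓ gL ign)
                 (sublistSum-ignoresMarked L (P ∘ (x ∷_)) (ℓ ∘ suc) gL (ignoresMarked-∷ {P} x gx ign)) ⟩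
      sublistSum L′ P (stepSum c ℓ) + sublistSum L′ (P ∘ (x ∷_)) (stepSum c (ℓ ∘ suc))
    ≡⟨ cong (sublistSum L′ P (stepSum c ℓ) +_)
            (sublistSum-congʷ L′ (P ∘ (x ∷_)) (λ {N} _ _ → stepSum-suc c ℓ (length N))) ⟩
      sublistSum L′ P (stepSum c ℓ) + sublistSum L′ (P ∘ (x ∷_)) (stepSum c ℓ ∘ suc)
    ≡⟨⟩
      sublistSum (x ∷ L′) P (stepSum c ℓ)
    ∎
    where
    open ≡-Reasoning
    L′ : List A
    L′ = unmarked L
    c : ℕ
    c  = count marked L

  containsMarked-∷ : ∀ {x} L {N} → All (λ y → T (marked y) → ¬ x ≡ y) L →
    containsMarked L (x ∷ N) ≡ containsMarked L N
  containsMarked-∷ L {N} x≢ = T-ext forth back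
    where
    forth : T (containsMarked L (_ ∷ N)) → T (containsMarked L N)
    forth t = containsMarked⁺ L {N} (All.zipWith (λ (x≢y , h) my → ∈-∷⁻ (h my) (x≢y my)) (x≢ , containsMarked⁻ L t))
    back : T (containsMarked L N) → T (containsMarked L (_ ∷ N))
    back t = containsMarked⁺ L {_ ∷ N} (All.map (there ∘_) (containsMarked⁻ L t))

  sublistSum-containsMarked : ∀ L P ℓ → All Good L → Unique L → IgnoresMarked P →
    sublistSum L (λ N → P N ∧ containsMarked L N) ℓ ≡
    sublistSum (unmarked L) P (λ a → ℓ (a + count marked L))
  sublistSum-containsMarked []      P ℓ _ _ _ = sublistSum-congᴾ [] ℓ (λ {N} _ → ∧-identityʳ (P N))
  sublistSum-containsMarked (x ∷ L) P ℓ (gx ∷ gL) (x∉L ∷ uL) ign with marked x in e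
  ... | true  = begin
      sublistSum (x ∷ L) (λ N → P N ∧ (does (x ∈ˡ? N) ∧ containsMarked L N)) ℓ
    ≡⟨⟩
      sublistSum L (λ N → P N ∧ (does (x ∈ˡ? N) ∧ containsMarked L N)) ℓ +
      sublistSum L (λ N → P (x ∷ N) ∧ (does (x ∈ˡ? x ∷ N) ∧ containsMarked L (x ∷ N))) (ℓ ∘ suc)
    ≡⟨ cong₂ _+_ (sublistSum-zero L _ ℓ misses-x) (sublistSum-congᴾ L (ℓ ∘ suc) drop-x) ⟩
      0 + sublistSum L (λ N → P N ∧ containsMarked L N) (ℓ ∘ suc)
    ≡⟨ sublistSum-containsMarked L P (ℓ ∘ suc) gL uL ign ⟩
      sublistSum (unmarked L) P (λ a → ℓ (suc (a + count marked L)))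
    ≡⟨ sublistSum-congʷ (unmarked L) P (λ {N} _ _ → cong ℓ (sym (+-suc (length N) _))) ⟩
      sublistSum (unmarked L) P (λ a → ℓ (a + suc (count marked L)))
    ∎
    where
    open ≡-Reasoning
    misses-x : ∀ {N} → N ⊑ L → T (P N ∧ (does (x ∈ˡ? N) ∧ containsMarked L N)) → ℓ (length N) ≡ 0
    misses-x {N} s t =
      ⊥-elim (All¬⇒¬Any (All-resp-⊆ s x∉L) (does⇒ (x ∈ˡ? N) (proj₁ (to T-∧ (proj₂ (to (T-∧ {P N}) t))))))
    drop-x : ∀ {N} → N ⊑ L →
      (P (x ∷ N) ∧ (does (x ∈ˡ? x ∷ N) ∧ containsMarked L (x ∷ N))) ≡ (P N ∧ containsMarked L N)
    drop-x {N} s = cong₂ _∧_ (ign [] N x (subst T (sym e) tt) [] (All-resp-⊆ s gL))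
      (cong₂ _∧_ (dec-true (x ∈ˡ? x ∷ N) (here refl)) (containsMarked-∷ {x} L {N} (All.map (λ x≢y _ → x≢y) x∉L)))
  ... | false = begin
      sublistSum (x ∷ L) (λ N → P N ∧ containsMarked L N) ℓ
    ≡⟨⟩
      sublistSum L (λ N → P N ∧ containsMarked L N) ℓ +
      sublistSum L (λ N → P (x ∷ N) ∧ containsMarked L (x ∷ N)) (ℓ ∘ suc)
    ≡⟨ cong (sublistSum L (λ N → P N ∧ containsMarked L N) ℓ +_)
            (sublistSum-congᴾ L (ℓ ∘ suc) (λ {N} _ → cong (P (x ∷ N) ∧_) (containsMarked-∷ {x} L {N} x≢))) ⟩
      sublistSum L (λ N → P N ∧ containsMarked L N) ℓ +
      sublistSum L (λ N → P (x ∷ N) ∧ containsMarked L N) (ℓ ∘ suc)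
    ≡⟨ cong₂ _+_ (sublistSum-containsMarked L P ℓ gL uL ign)
                 (sublistSum-containsMarked L (P ∘ (x ∷_)) (ℓ ∘ suc) gL uL (ignoresMarked-∷ {P} x gx ign)) ⟩
      sublistSum L′ P (λ a → ℓ (a + c)) + sublistSum L′ (P ∘ (x ∷_)) (λ a → ℓ (suc (a + c)))
    ≡⟨⟩
      sublistSum (x ∷ L′) P (λ a → ℓ (a + c))
    ∎
    where
    open ≡-Reasoning
    L′ : List A
    L′ = unmarked L
    c : ℕ
    c  = count marked L
    x≢ : All (λ y → T (marked y) → ¬ x ≡ y) L
    x≢ = All.tabulate λ { _ my refl → subst T e my }

module _ {A V : Set} (_≟_ : DecidableEquality V) {vs : List V} (unique : Unique vs) (complete : ∀ v → v ∈ˡ vs) where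

  sublistSum-partition : ∀ (f : List A → V) L P ℓ →
    sublistSum L P ℓ ≡ sumOver vs (λ v → sublistSum L (λ N → P N ∧ does (f N ≟ v)) ℓ)
  sublistSum-partition f []      P ℓ =
    trans (sym (sumOver-≟ _≟_ (weight P ℓ []) unique (complete (f []))))
          (sumOver-cong vs (λ v → split (does (f [] ≟ v))))
    where
    split : ∀ b → (if b then weight P ℓ [] else 0) ≡ weight (λ N → P N ∧ b) ℓ []
    split b with P [] | b
    ... | true  | _     = refl
    ... | false | true  = refl
    ... | false | false = refl
  sublistSum-partition f (x ∷ L) P ℓ =
    trans (cong₂ _+_ (sublistSum-partition f L P ℓ) (sublistSum-partition (f ∘ (x ∷_)) L (P ∘ (x ∷_)) (ℓ ∘ suc)))
          (sym (sumOver-+ vs _ _))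

-- Polynomials

sumTo-cong : ∀ k {f g : ℕ → ℕ} → (∀ i → i ≤ k → f i ≡ g i) → sumTo k f ≡ sumTo k g
sumTo-cong zero    h = h 0 z≤n
sumTo-cong (suc k) h = cong₂ _+_ (sumTo-cong k (λ i → h i ∘ m≤n⇒m≤1+n)) (h (suc k) ≤-refl)

sumTo-+ : ∀ k (f g : ℕ → ℕ) → sumTo k (λ i → f i + g i) ≡ sumTo k f + sumTo k g
sumTo-+ zero    f g = refl
sumTo-+ (suc k) f g =
  trans (cong (_+ (f (suc k) + g (suc k))) (sumTo-+ k f g)) (+-interchange (sumTo k f) (sumTo k g) _ _)

sumTo-zero : ∀ k (f : ℕ → ℕ) → (∀ i → i ≤ k → f i ≡ 0) → sumTo k f ≡ 0
sumTo-zero k f h = trans (sumTo-cong k h) (zeros k)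
  where
  zeros : ∀ k → sumTo k (λ _ → 0) ≡ 0
  zeros zero    = refl
  zeros (suc k) = cong (_+ 0) (zeros k)

sumTo-single : ∀ k (f : ℕ → ℕ) {j} → j ≤ k → (∀ i → i ≤ k → ¬ i ≡ j → f i ≡ 0) → sumTo k f ≡ f j
sumTo-single zero    f z≤n h = refl
sumTo-single (suc k) f {j} j≤1+k h with j ≟ suc k
... | yes refl = cong (_+ f (suc k)) (sumTo-zero k f λ i i≤k →
                   h i (m≤n⇒m≤1+n i≤k) (λ where refl → <⇒≱ (s≤s i≤k) ≤-refl))
... | no  j≢1+k = trans (cong₂ _+_ (sumTo-single k f (≤-pred (≤∧≢⇒< j≤1+k j≢1+k)) (λ i → h i ∘ m≤n⇒m≤1+n))
                                    (h (suc k) ≤-refl (j≢1+k ∘ sym)))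
                        (+-identityʳ (f j))

tpow-*ₚ : ∀ {m k} (q : Poly) → m ≤ k → (tpow m *ₚ q) k ≡ q (k ∸ m)
tpow-*ₚ {m} {k} q m≤k = begin
    sumTo k (λ i → tpow m i * q (k ∸ i))
  ≡⟨ sumTo-single k _ m≤k (λ i _ i≢m → cong (_* q (k ∸ i)) (𝟙-≡ᵇ-≢ {m} {i} (i≢m ∘ sym))) ⟩
    tpow m m * q (k ∸ m)
  ≡⟨ cong (_* q (k ∸ m)) (𝟙-≡ᵇ-refl m) ⟩
    1 * q (k ∸ m)
  ≡⟨ *-identityˡ _ ⟩
    q (k ∸ m)
  ∎
  where open ≡-Reasoning

tpow-*ₚ-< : ∀ {m k} (q : Poly) → k < m → (tpow m *ₚ q) k ≡ 0
tpow-*ₚ-< {m} {k} q k<m =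
  sumTo-zero k _ (λ i i≤k → cong (_* q (k ∸ i)) (𝟙-≡ᵇ-≢ {m} {i} λ where refl → <⇒≱ k<m i≤k))

*ₚ-tpow : ∀ {m k} (p : Poly) → m ≤ k → (p *ₚ tpow m) k ≡ p (k ∸ m)
*ₚ-tpow {m} {k} p m≤k = begin
    sumTo k (λ i → p i * tpow m (k ∸ i))
  ≡⟨ sumTo-single k _ (m∸n≤m k m) (λ i i≤k i≢k∸m → trans (cong (p i *_) (𝟙-≡ᵇ-≢ {m} {k ∸ i} λ m≡k∸i →
       i≢k∸m (trans (sym (m∸[m∸n]≡n i≤k)) (cong (k ∸_) (sym m≡k∸i))))) (*-zeroʳ (p i))) ⟩
    p (k ∸ m) * tpow m (k ∸ (k ∸ m))
  ≡⟨ cong (λ j → p (k ∸ m) * tpow m j) (m∸[m∸n]≡n m≤k) ⟩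
    p (k ∸ m) * tpow m m
  ≡⟨ cong (p (k ∸ m) *_) (𝟙-≡ᵇ-refl m) ⟩
    p (k ∸ m) * 1
  ≡⟨ *-identityʳ _ ⟩
    p (k ∸ m)
  ∎
  where open ≡-Reasoning

*ₚ-tpow-< : ∀ {m k} (p : Poly) → k < m → (p *ₚ tpow m) k ≡ 0
*ₚ-tpow-< {m} {k} p k<m =
  sumTo-zero k _ (λ i _ → trans (cong (p i *_) (𝟙-≡ᵇ-≢ {m} {k ∸ i} λ where refl → <⇒≱ k<m (m∸n≤m k i))) (*-zeroʳ (p i)))

shiftₚ : Poly → Poly
shiftₚ q zero    = 0
shiftₚ q (suc k) = q k

*ₚ-shiftₚ : ∀ (p q : Poly) k → (p *ₚ shiftₚ q) k ≡ shiftₚ (p *ₚ q) k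
*ₚ-shiftₚ p q zero    = *-zeroʳ (p 0)
*ₚ-shiftₚ p q (suc k) =
  trans (cong₂ _+_ (sumTo-cong k (λ i i≤k → cong (λ j → p i * shiftₚ q j) (+-∸-assoc 1 i≤k)))
                   (trans (cong (λ j → p (suc k) * shiftₚ q j) (n∸n≡0 k)) (*-zeroʳ (p (suc k)))))
        (+-identityʳ _)

t+1-*ₚ : ∀ (q : Poly) k → (t+1 *ₚ q) k ≡ shiftₚ q k + q k
t+1-*ₚ q k = begin
    sumTo k (λ i → (tpow 1 i + tpow 0 i) * q (k ∸ i))
  ≡⟨ sumTo-cong k (λ i _ → *-distribʳ-+ (q (k ∸ i)) (tpow 1 i) (tpow 0 i)) ⟩
    sumTo k (λ i → tpow 1 i * q (k ∸ i) + tpow 0 i * q (k ∸ i))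
  ≡⟨ sumTo-+ k _ _ ⟩
    (tpow 1 *ₚ q) k + (tpow 0 *ₚ q) k
  ≡⟨ cong₂ _+_ (t-*ₚ k) (tpow-*ₚ {0} {k} q z≤n) ⟩
    shiftₚ q k + q k
  ∎
  where
  open ≡-Reasoning
  t-*ₚ : ∀ k → (tpow 1 *ₚ q) k ≡ shiftₚ q k
  t-*ₚ zero    = tpow-*ₚ-< {1} q (s≤s z≤n)
  t-*ₚ (suc k) = tpow-*ₚ {1} q (s≤s z≤n)

*ₚ-[t+1]^suc : ∀ (p : Poly) m k →
  (p *ₚ (t+1 ^ₚ suc m)) k ≡ shiftₚ (p *ₚ (t+1 ^ₚ m)) k + (p *ₚ (t+1 ^ₚ m)) k
*ₚ-[t+1]^suc p m k = begin
    sumTo k (λ i → p i * (t+1 *ₚ q) (k ∸ i))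
  ≡⟨ sumTo-cong k (λ i _ → trans (cong (p i *_) (t+1-*ₚ q (k ∸ i))) (*-distribˡ-+ (p i) _ _)) ⟩
    sumTo k (λ i → p i * shiftₚ q (k ∸ i) + p i * q (k ∸ i))
  ≡⟨ sumTo-+ k _ _ ⟩
    (p *ₚ shiftₚ q) k + (p *ₚ q) k
  ≡⟨ cong (_+ (p *ₚ q) k) (*ₚ-shiftₚ p q k) ⟩
    shiftₚ (p *ₚ q) k + (p *ₚ q) k
  ∎
  where
  open ≡-Reasoning
  q = t+1 ^ₚ m

Σₚ-apply : ∀ {A : Set} xs (f : A → Poly) k → Σₚ xs f k ≡ sumOver xs (λ x → f x k)
Σₚ-apply []       f k = refl
Σₚ-apply (x ∷ xs) f k = cong (f x k +_) (Σₚ-apply xs f k)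

δ : ℕ → ℕ → ℕ
δ k a = 𝟙 (a ≡ᵇ k)

δ-+ : ∀ {c k} a → c ≤ k → δ (k ∸ c) a ≡ δ k (a + c)
δ-+ {c} {k} a c≤k =
  𝟙-≡ᵇ-cong (λ e → trans (cong (_+ c) e) (m∸n+n≡m c≤k)) (λ e → trans (sym (m+n∸n≡m a c)) (cong (_∸ c) e))

record IsLengthGF {A : Set} (L : List A) (P : List A → Bool) (p : Poly) : Set where
  field coeff : ∀ k → p k ≡ sublistSum L P (δ k)

record IsReversedGF {A : Set} (L : List A) (P : List A → Bool) (d : ℕ) (p : Poly) : Set where
  field coeff : ∀ i → p i ≡ sublistSum L P (λ a → δ d (a + i))

open IsLengthGF
open IsReversedGF

module _ {A : Set} {L : List A} {P : List A → Bool} where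

  lengthGF-*ₚ-[t+1]^ : ∀ {p} → IsLengthGF L P p → ∀ m k →
    (p *ₚ (t+1 ^ₚ m)) k ≡ sublistSum L P (stepSum m (δ k))
  lengthGF-*ₚ-[t+1]^ {p} gf zero k = trans (*ₚ-tpow {0} {k} p z≤n) (coeff gf k)
  lengthGF-*ₚ-[t+1]^ {p} gf (suc m) zero = begin
      (p *ₚ (t+1 ^ₚ suc m)) 0
    ≡⟨ *ₚ-[t+1]^suc p m 0 ⟩
      (p *ₚ (t+1 ^ₚ m)) 0
    ≡⟨ lengthGF-*ₚ-[t+1]^ gf m 0 ⟩
      sublistSum L P (stepSum m (δ 0))
    ≡⟨ sublistSum-congʷ L P (λ {N} _ _ → stepSum-cong m (λ a → sym (+-identityʳ (δ 0 a))) (length N)) ⟩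
      sublistSum L P (stepSum (suc m) (δ 0))
    ∎
    where open ≡-Reasoning
  lengthGF-*ₚ-[t+1]^ {p} gf (suc m) (suc k) = begin
      (p *ₚ (t+1 ^ₚ suc m)) (suc k)
    ≡⟨ *ₚ-[t+1]^suc p m (suc k) ⟩
      (p *ₚ (t+1 ^ₚ m)) k + (p *ₚ (t+1 ^ₚ m)) (suc k)
    ≡⟨ cong₂ _+_ (lengthGF-*ₚ-[t+1]^ gf m k) (lengthGF-*ₚ-[t+1]^ gf m (suc k)) ⟩
      sublistSum L P (stepSum m (δ k)) + sublistSum L P (stepSum m (δ (suc k)))
    ≡⟨ sublistSum-+ L P _ _ ⟨
      sublistSum L P (λ a → stepSum m (δ k) a + stepSum m (δ (suc k)) a)
    ≡⟨ sublistSum-congʷ L P (λ {N} _ _ → trans (sym (stepSum-+ m (δ k) (δ (suc k)) (length N)))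
                                                (stepSum-cong m (λ b → +-comm (δ k b) _) (length N))) ⟩
      sublistSum L P (stepSum (suc m) (δ (suc k)))
    ∎
    where open ≡-Reasoning

  reversedGF-*ₚ-[t+1]^ : ∀ {p d} → IsReversedGF L P d p → (∀ {N} → N ⊑ L → T (P N) → length N ≤ d) →
    ∀ m i → (p *ₚ (t+1 ^ₚ m)) i ≡ sublistSum L P (stepSum m (λ a → δ (d + m) (a + i)))
  reversedGF-*ₚ-[t+1]^ {p} {d} gf _ zero i =
    trans (*ₚ-tpow {0} {i} p z≤n) (trans (coeff gf i)
      (sublistSum-congʷ L P (λ {N} _ _ → cong (λ D → δ D (length N + i)) (sym (+-identityʳ d)))))
  reversedGF-*ₚ-[t+1]^ {p} {d} gf bound (suc m) zero = begin
      (p *ₚ (t+1 ^ₚ suc m)) 0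
    ≡⟨ *ₚ-[t+1]^suc p m 0 ⟩
      (p *ₚ (t+1 ^ₚ m)) 0
    ≡⟨ reversedGF-*ₚ-[t+1]^ gf bound m 0 ⟩
      sublistSum L P (stepSum m (λ a → δ (d + m) (a + 0)))
    ≡⟨ sublistSum-congʷ L P (λ {N} _ _ → stepSum-cong m (sym ∘ X∘suc) (length N)) ⟩
      sublistSum L P (stepSum m (X ∘ suc))
    ≡⟨ cong (_+ sublistSum L P (stepSum m (X ∘ suc))) too-long ⟨
      sublistSum L P (stepSum m X) + sublistSum L P (stepSum m (X ∘ suc))
    ≡⟨ sublistSum-+ L P _ _ ⟨
      sublistSum L P (λ a → stepSum m X a + stepSum m (X ∘ suc) a)
    ≡⟨ sublistSum-congʷ L P (λ {N} _ _ → sym (stepSum-+ m X (X ∘ suc) (length N))) ⟩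
      sublistSum L P (stepSum (suc m) X)
    ∎
    where
    open ≡-Reasoning
    X : ℕ → ℕ
    X a = δ (d + suc m) (a + 0)
    X∘suc : ∀ a → X (suc a) ≡ δ (d + m) (a + 0)
    X∘suc a = cong (λ D → δ D (suc a + 0)) (+-suc d m)
    too-long : sublistSum L P (stepSum m X) ≡ 0
    too-long = sublistSum-zero L P _ λ {N} s t → stepSum-vanishes m X (length N) λ j j≤m →
      𝟙-≡ᵇ-≢ λ e → 1+n≰n (subst (_≤ d + m) (trans e (+-suc d m))
                              (≤-trans (≤-reflexive (+-identityʳ _)) (+-mono-≤ (bound s t) j≤m)))
  reversedGF-*ₚ-[t+1]^ {p} {d} gf bound (suc m) (suc i) = begin
      (p *ₚ (t+1 ^ₚ suc m)) (suc i)
    ≡⟨ *ₚ-[t+1]^suc p m (suc i) ⟩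
      (p *ₚ (t+1 ^ₚ m)) i + (p *ₚ (t+1 ^ₚ m)) (suc i)
    ≡⟨ cong₂ _+_ (reversedGF-*ₚ-[t+1]^ gf bound m i) (reversedGF-*ₚ-[t+1]^ gf bound m (suc i)) ⟩
      sublistSum L P (stepSum m Y₁) + sublistSum L P (stepSum m Y₂)
    ≡⟨ sublistSum-+ L P _ _ ⟨
      sublistSum L P (λ a → stepSum m Y₁ a + stepSum m Y₂ a)
    ≡⟨ sublistSum-congʷ L P (λ {N} _ _ → trans (sym (stepSum-+ m Y₁ Y₂ (length N))) (stepSum-cong m split (length N))) ⟩
      sublistSum L P (stepSum (suc m) X)
    ∎
    where
    open ≡-Reasoning
    Y₁ Y₂ X : ℕ → ℕ
    Y₁ a = δ (d + m) (a + i)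
    Y₂ a = δ (d + m) (a + suc i)
    X  a = δ (d + suc m) (a + suc i)
    split : ∀ a → Y₁ a + Y₂ a ≡ X a + X (suc a)
    split a = cong₂ _+_ (cong₂ δ (sym (+-suc d m)) (sym (+-suc a i)))
                        (cong (λ D → δ D (suc a + suc i)) (sym (+-suc d m)))

  tpow-*ₚ-lengthGF : ∀ {p} → IsLengthGF L P p → ∀ μ k → (tpow μ *ₚ p) k ≡ sublistSum L P (λ a → δ k (a + μ))
  tpow-*ₚ-lengthGF {p} gf μ k with μ ≤? k
  ... | yes μ≤k =
    trans (tpow-*ₚ p μ≤k) (trans (coeff gf (k ∸ μ)) (sublistSum-congʷ L P (λ {N} _ _ → δ-+ (length N) μ≤k)))
  ... | no  μ≰k = trans (tpow-*ₚ-< p (≰⇒> μ≰k)) (sym (sublistSum-zero L P _ λ {N} _ _ →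
                    𝟙-≡ᵇ-≢ λ e → μ≰k (subst (μ ≤_) e (m≤n+m μ (length N)))))

  reversedGF-*ₚ-tpow : ∀ {p d} → IsReversedGF L P d p → (∀ {N} → N ⊑ L → T (P N) → length N ≤ d) →
    ∀ r i → (p *ₚ tpow r) i ≡ sublistSum L P (λ a → δ (d + r) (a + i))
  reversedGF-*ₚ-tpow {p} {d} gf bound r i with r ≤? i
  ... | yes r≤i = trans (*ₚ-tpow p r≤i) (trans (coeff gf (i ∸ r)) (sublistSum-congʷ L P (λ {N} _ _ → shift (length N))))
    where
    shift : ∀ a → δ d (a + (i ∸ r)) ≡ δ (d + r) (a + i)
    shift a = 𝟙-≡ᵇ-cong (λ e → trans a+i (cong (_+ r) e)) (λ e → +-cancelʳ-≡ r _ _ (trans (sym a+i) e))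
      where
      a+i : a + i ≡ a + (i ∸ r) + r
      a+i = trans (cong (a +_) (sym (m∸n+n≡m r≤i))) (sym (+-assoc a (i ∸ r) r))
  ... | no  r≰i = trans (*ₚ-tpow-< p (≰⇒> r≰i)) (sym (sublistSum-zero L P _ λ {N} s t →
                    𝟙-≡ᵇ-≢ λ e → r≰i (+-cancelˡ-≤ d r i (subst (_≤ d + i) e (+-monoˡ-≤ i (bound s t))))))

-- Subsets of Fin n

_≟ˢ_ : ∀ {n} → DecidableEquality (Subset n)
_≟ˢ_ = ≡-dec Bool._≟_

∈-allSubsets : ∀ {n} (J : Subset n) → J ∈ˡ allSubsets n
∈-allSubsets []              = here refl
∈-allSubsets {suc n} (outside ∷ J) = ∈-++⁺ˡ (∈-map⁺ (outside ∷_) (∈-allSubsets J))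
∈-allSubsets {suc n} (inside  ∷ J) = ∈-++⁺ʳ (map (outside ∷_) (allSubsets n)) (∈-map⁺ (inside ∷_) (∈-allSubsets J))

allSubsets-unique : ∀ n → Unique (allSubsets n)
allSubsets-unique zero    = [] ∷ []
allSubsets-unique (suc n) =
  Unique.++⁺ (Unique.map⁺ ∷-injectiveʳ (allSubsets-unique n)) (Unique.map⁺ ∷-injectiveʳ (allSubsets-unique n))
    λ (m₁ , m₂) → outside≢inside (trans (sym (head-of m₁)) (head-of m₂))
  where
  head-of : ∀ {b} {v : Subset (suc n)} {xs} → v ∈ˡ map (b ∷_) xs → head v ≡ b
  head-of m with ∈-map⁻ _ m
  ... | _ , _ , refl = refl
  outside≢inside : ¬ outside ≡ inside
  outside≢inside ()

module _ {n : ℕ} where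

  ∈-⋃⁻ : ∀ (N : List (Subset n)) {x} → x ∈ ⋃ N → ∃ λ I → I ∈ˡ N × x ∈ I
  ∈-⋃⁻ []      x∈ = ⊥-elim (∉⊥ x∈)
  ∈-⋃⁻ (I ∷ N) x∈ with x∈p∪q⁻ I (⋃ N) x∈
  ... | inj₁ x∈I = I , here refl , x∈I
  ... | inj₂ x∈⋃ with ∈-⋃⁻ N x∈⋃
  ...   | J , J∈N , x∈J = J , there J∈N , x∈J

  ∈-⋃⁺ : ∀ {N : List (Subset n)} {I x} → I ∈ˡ N → x ∈ I → x ∈ ⋃ N
  ∈-⋃⁺ (here refl) x∈I = x∈p∪q⁺ (inj₁ x∈I)
  ∈-⋃⁺ (there I∈N) x∈I = x∈p∪q⁺ (inj₂ (∈-⋃⁺ I∈N x∈I))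

  ⋃-⊆ : ∀ {S} (N : List (Subset n)) → All (_⊆ S) N → ⋃ N ⊆ S
  ⋃-⊆ N N⊆S x∈ with ∈-⋃⁻ N x∈
  ... | I , I∈N , x∈I = All.lookup N⊆S I∈N x∈I

  ⊆∧⊄⇒⊇ : ∀ {J K : Subset n} → J ⊆ K → ¬ J ⊂ K → K ⊆ J
  ⊆∧⊄⇒⊇ {J} J⊆K J⊄K {x} x∈K with x ∈? J
  ... | yes x∈J = x∈J
  ... | no  x∉J = ⊥-elim (J⊄K (J⊆K , x , x∈K , x∉J))

  ⊆∧≢⇒⊂ : ∀ {J K : Subset n} → J ⊆ K → ¬ J ≡ K → J ⊂ K
  ⊆∧≢⇒⊂ {J} {K} J⊆K J≢K with J ⊂? K
  ... | yes J⊂K = J⊂K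
  ... | no  J⊄K = ⊥-elim (J≢K (⊆-antisym J⊆K (⊆∧⊄⇒⊇ J⊆K J⊄K)))

module Tops {n : ℕ} (N : List (Subset n)) (J : Subset n) where

  IsTop : Subset n → Set
  IsTop I = I ⊆ J × All (λ K → ¬ (K ⊆ J × I ⊂ K)) N

  isTop? : Relation.Unary.Decidable IsTop
  isTop? I = (I ⊆? J) ×-dec All.all? (λ K → ¬? ((K ⊆? J) ×-dec (I ⊂? K))) N

  -- climbing along strict inclusions stops because cardinalities are bounded by n
  below-top : ∀ {I} → I ∈ˡ N → I ⊆ J → ∃ λ I* → I* ∈ˡ N × IsTop I* × I ⊆ I*
  below-top {I} = climb (suc n) (m≤n+m (suc n) ∣ I ∣)
    where
    climb : ∀ k {I} → n < ∣ I ∣ + k → I ∈ˡ N → I ⊆ J → ∃ λ I* → I* ∈ˡ N × IsTop I* × I ⊆ I*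
    climb zero    {I} bound _ _ = ⊥-elim (<⇒≱ bound (subst (_≤ n) (sym (+-identityʳ _)) (∣p∣≤n I)))
    climb (suc k) {I} bound I∈N I⊆J with All.all? (λ K → ¬? ((K ⊆? J) ×-dec (I ⊂? K))) N
    ... | yes top = I , I∈N , (I⊆J , top) , λ x∈ → x∈
    ... | no ¬top with find (¬All⇒Any¬ (λ K → ¬? ((K ⊆? J) ×-dec (I ⊂? K))) N ¬top)
    ...   | K , K∈N , ¬¬above with decidable-stable ((K ⊆? J) ×-dec (I ⊂? K)) ¬¬above
    ...     | K⊆J , I⊂K
      with climb k (≤-trans bound (≤-trans (≤-reflexive (+-suc ∣ I ∣ k)) (+-monoˡ-≤ k (p⊂q⇒∣p∣<∣q∣ I⊂K)))) K∈N K⊆J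
    ...       | I* , I*∈N , top , K⊆I* = I* , I*∈N , top , ⊆-trans (proj₁ I⊂K) K⊆I*

-- Nested collections

-- A building set without the singleton axiom; unlike building sets, these pass to restrictions.
record IsUnionClosed {n : ℕ} (B : Family n) : Set where
  field
    nonempty : ∀ I → I ∈ᶠ B → Nonempty I
    union    : ∀ I J → I ∈ᶠ B → J ∈ᶠ B → Nonempty (I ∩ J) → (I ∪ J) ∈ᶠ B

module UnionClosed {n : ℕ} (B : Family n) (isUnionClosed : IsUnionClosed B) where

  open IsUnionClosed isUnionClosed

  Disjoint : Subset n → Subset n → Set
  Disjoint I J = ¬ Nonempty (I ∩ J)

  NestedOrDisjoint : Subset n → Subset n → Set
  NestedOrDisjoint I J = I ⊆ J ⊎ J ⊆ I ⊎ Disjoint I J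

  nestedOrDisjoint-sym : ∀ {I J} → NestedOrDisjoint I J → NestedOrDisjoint J I
  nestedOrDisjoint-sym (inj₁ I⊆J)        = inj₂ (inj₁ I⊆J)
  nestedOrDisjoint-sym (inj₂ (inj₁ J⊆I)) = inj₁ J⊆I
  nestedOrDisjoint-sym {I} {J} (inj₂ (inj₂ I∩J=∅)) = inj₂ (inj₂ (I∩J=∅ ∘ subst Nonempty (∩-comm J I)))

  IsNested : List (Subset n) → Set
  IsNested N = AllPairs NestedOrDisjoint N ×
               (∀ {M} → M ⊑ N → 2 ≤ length M → AllPairs Disjoint M → ¬ (⋃ M ∈ᶠ B))

  isNested-⊑ : ∀ {N′ N} → N′ ⊑ N → IsNested N → IsNested N′
  isNested-⊑ s (pairs , noUnion) = AllPairs-resp-⊑ s pairs , λ s′ → noUnion (⊑-trans s′ s)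

  disjointᵇ⇔ : ∀ {I J} → (T (disjointᵇ I J) → Disjoint I J) × (Disjoint I J → T (disjointᵇ I J))
  disjointᵇ⇔ {I} {J} = does⇒¬ (nonempty? (I ∩ J)) , ¬⇒does (nonempty? (I ∩ J))

  nestedOrDisjointᵇ⇒ : ∀ {I J} → T (nestedOrDisjointᵇ I J) → NestedOrDisjoint I J
  nestedOrDisjointᵇ⇒ {I} {J} t =
    Sum.map (does⇒ (I ⊆? J)) (Sum.map (does⇒ (J ⊆? I)) (proj₁ disjointᵇ⇔) ∘ to T-∨) (to T-∨ t)

  nestedOrDisjointᵇ⇐ : ∀ {I J} → NestedOrDisjoint I J → T (nestedOrDisjointᵇ I J)
  nestedOrDisjointᵇ⇐ {I} {J} nd =
    from T-∨ (Sum.map (does⇐ (I ⊆? J)) (from T-∨ ∘ Sum.map (does⇐ (J ⊆? I)) (proj₂ disjointᵇ⇔)) nd)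

  isNestedᵇ⇒ : ∀ N → T (isNestedᵇ B N) → IsNested N
  isNestedᵇ⇒ N t = AllPairs.map nestedOrDisjointᵇ⇒ (T-allPairs⁻ N (proj₁ (to T-∧ t))) , noUnion
    where
    noUnion : ∀ {M} → M ⊑ N → 2 ≤ length M → AllPairs Disjoint M → ¬ (⋃ M ∈ᶠ B)
    noUnion s 2≤∣M∣ disj ⋃M∈B =
      T-not⇒¬ (all-sublists⁻ (T-allᵇ⁻ (sublists N) (proj₂ (to T-∧ t))) s)
        (from T-∧ (≤⇒≤ᵇ 2≤∣M∣ , from T-∧ (T-allPairs⁺ (AllPairs.map (proj₂ disjointᵇ⇔) disj) , ⋃M∈B)))

  isNestedᵇ⇐ : ∀ N → IsNested N → T (isNestedᵇ B N)
  isNestedᵇ⇐ N (pairs , noUnion) =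
    from T-∧ (T-allPairs⁺ (AllPairs.map nestedOrDisjointᵇ⇐ pairs) ,
              T-allᵇ⁺ (all-sublists⁺ N λ {M} s → ¬⇒T-not λ t →
                let (2≤ , t′) = to T-∧ t; (disj , ⋃M∈B) = to T-∧ t′ in
                noUnion s (≤ᵇ⇒≤ 2 (length M) 2≤) (AllPairs.map (proj₁ disjointᵇ⇔) (T-allPairs⁻ M disj)) ⋃M∈B))

  IsMaximal : Subset n → Set
  IsMaximal J = J ∈ᶠ B × (∀ K → K ∈ᶠ B → ¬ J ⊂ K)

  isMaxᵇ⇒ : ∀ {J} → T (isMaxᵇ B J) → IsMaximal J
  isMaxᵇ⇒ {J} t = proj₁ (to T-∧ t) , λ K K∈B J⊂K →
    T-not⇒¬ (All.lookup (T-allᵇ⁻ (allSubsets n) (proj₂ (to (T-∧ {B J}) t))) (∈-allSubsets K))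
            (from T-∧ (K∈B , does⇐ (J ⊂? K) J⊂K))

  isMaxᵇ⇐ : ∀ {J} → IsMaximal J → T (isMaxᵇ B J)
  isMaxᵇ⇐ {J} (J∈B , top) = from T-∧ (J∈B , T-allᵇ⁺ {xs = allSubsets n} (All.tabulate λ {K} _ → ¬⇒T-not λ t →
    let (K∈B , J⊂K) = to T-∧ t in top K K∈B (does⇒ (J ⊂? K) J⊂K)))

  maximal-absorbs : ∀ {y I} → IsMaximal y → I ∈ᶠ B → Nonempty (I ∩ y) → I ⊆ y
  maximal-absorbs {y} {I} (y∈B , top) I∈B meet =
    ⊆-trans (p⊆p∪q y) (⊆∧⊄⇒⊇ (q⊆p∪q I y) (top (I ∪ y) (union I y I∈B y∈B meet)))

  maximal-nestedOrDisjoint : ∀ {y I} → IsMaximal y → I ∈ᶠ B → NestedOrDisjoint I y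
  maximal-nestedOrDisjoint {y} {I} max I∈B with nonempty? (I ∩ y)
  ... | yes meet = inj₁ (maximal-absorbs max I∈B meet)
  ... | no  I∩y=∅ = inj₂ (inj₂ I∩y=∅)

  private
    ⊑-insert-or : ∀ N₁ {N₂ : List (Subset n)} {y M} → M ⊑ N₁ ++ y ∷ N₂ → y ∈ˡ M ⊎ M ⊑ N₁ ++ N₂
    ⊑-insert-or []       (_ ∷ʳ s)   = inj₂ s
    ⊑-insert-or []       (refl ∷ s) = inj₁ (here refl)
    ⊑-insert-or (x ∷ N₁) (_ ∷ʳ s)   = Sum.map₂ (x ∷ʳ_) (⊑-insert-or N₁ s)
    ⊑-insert-or (x ∷ N₁) (refl ∷ s) = Sum.map there (refl ∷_) (⊑-insert-or N₁ s)

    AllPairs-insert : ∀ {R : Subset n → Subset n → Set} N₁ {N₂ y} → AllPairs R (N₁ ++ N₂) →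
      All (λ z → R z y) N₁ → All (R y) N₂ → AllPairs R (N₁ ++ y ∷ N₂)
    AllPairs-insert []       pairs             _          y₂ = y₂ ∷ pairs
    AllPairs-insert (x ∷ N₁) (x-rest ∷ pairs) (rxy ∷ y₁) y₂ =
      All.++⁺ (All.++⁻ˡ N₁ x-rest) (rxy ∷ All.++⁻ʳ N₁ x-rest) ∷ AllPairs-insert N₁ pairs y₁ y₂

    partner : ∀ {R : Subset n → Subset n → Set} {M y} → AllPairs R M → y ∈ˡ M → 2 ≤ length M →
      ∃ λ z → z ∈ˡ M × (R y z ⊎ R z y)
    partner {M = _ ∷ z ∷ _} (r ∷ _)  (here refl) _ = z , there (here refl) , inj₁ (All.head r)
    partner {M = _ ∷ []}    _        (here refl) (s≤s ())
    partner                 (r ∷ _)  (there y∈M) _ = _ , here refl , inj₂ (All.lookup r y∈M)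

  isNested-insertMaximal : ∀ N₁ N₂ {y} → IsMaximal y → All (_∈ᶠ B) N₁ → All (_∈ᶠ B) N₂ →
    isNestedᵇ B (N₁ ++ y ∷ N₂) ≡ isNestedᵇ B (N₁ ++ N₂)
  isNested-insertMaximal N₁ N₂ {y} max N₁⊆B N₂⊆B = T-ext
    (isNestedᵇ⇐ _ ∘ isNested-⊑ (++⁺ (⊑-refl {x = N₁}) (y ∷ʳ ⊑-refl {x = N₂})) ∘ isNestedᵇ⇒ _)
    (isNestedᵇ⇐ _ ∘ insert ∘ isNestedᵇ⇒ _)
    where
    insert : IsNested (N₁ ++ N₂) → IsNested (N₁ ++ y ∷ N₂)
    insert (pairs , noUnion) =
      AllPairs-insert N₁ pairs (All.map (maximal-nestedOrDisjoint max) N₁⊆B)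
                               (All.map (nestedOrDisjoint-sym ∘ maximal-nestedOrDisjoint max) N₂⊆B) ,
      noUnion′
      where
      members-in-B : ∀ {M} → M ⊑ N₁ ++ y ∷ N₂ → All (_∈ᶠ B) M
      members-in-B s = All-resp-⊆ s (All.++⁺ N₁⊆B (proj₁ max ∷ N₂⊆B))
      -- a union of disjoint members through y lies in y, which leaves no room for the other members
      noUnion′ : ∀ {M} → M ⊑ N₁ ++ y ∷ N₂ → 2 ≤ length M → AllPairs Disjoint M → ¬ (⋃ M ∈ᶠ B)
      noUnion′ s 2≤∣M∣ disj ⋃M∈B with ⊑-insert-or N₁ s
      ... | inj₂ s′  = noUnion s′ 2≤∣M∣ disj ⋃M∈B
      ... | inj₁ y∈M with partner disj y∈M 2≤∣M∣
      ...   | z , z∈M , y∩z=∅ with nonempty y (proj₁ max) | nonempty z (All.lookup (members-in-B s) z∈M)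
      ...     | x , x∈y | w , w∈z =
        Sum.[ (λ d → d (w , x∈p∩q⁺ (w∈y , w∈z))) , (λ d → d (w , x∈p∩q⁺ (w∈z , w∈y))) ] y∩z=∅
        where
        w∈y : w ∈ y
        w∈y = maximal-absorbs max ⋃M∈B (x , x∈p∩q⁺ (∈-⋃⁺ y∈M x∈y , x∈y)) (∈-⋃⁺ z∈M w∈z)

  -- The topmost members of N inside J are disjoint and cover J, so as N is nested there is only one.
  covered⇒∈ : ∀ {N J} → Unique N → IsNested N → J ∈ᶠ B →
    (∀ {x} → x ∈ J → ∃ λ I → I ∈ˡ N × x ∈ I × I ⊆ J) → J ∈ˡ N
  covered⇒∈ {N} {J} unique (pairs , noUnion) J∈B cover =
    conclude M (filter-⊆ isTop? N) tops-disjoint (⊆-antisym (⋃-⊆ M (All.map proj₁ tops)) J⊆⋃M)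
    where
    open Tops N J
    M : List (Subset n)
    M = filter isTop? N
    tops : All IsTop M
    tops = All.all-filter isTop? N
    tops-disjoint : AllPairs Disjoint M
    tops-disjoint = AllPairs-strengthen disjoint
      (All.zip (tops , All.tabulate (proj₁ ∘ ∈-filter⁻ isTop?)))
      (AllPairs-resp-⊑ (filter-⊆ isTop? N) (AllPairs.zip (pairs , unique)))
      where
      disjoint : ∀ {a b} → IsTop a × a ∈ˡ N → IsTop b × b ∈ˡ N → NestedOrDisjoint a b × ¬ a ≡ b → Disjoint a b
      disjoint ((_ , a-top) , _) ((b⊆J , _) , b∈N) (inj₁ a⊆b , a≢b) =
        ⊥-elim (All.lookup a-top b∈N (b⊆J , ⊆∧≢⇒⊂ a⊆b a≢b))
      disjoint ((a⊆J , _) , a∈N) ((_ , b-top) , _) (inj₂ (inj₁ b⊆a) , a≢b) =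
        ⊥-elim (All.lookup b-top a∈N (a⊆J , ⊆∧≢⇒⊂ b⊆a (a≢b ∘ sym)))
      disjoint _ _ (inj₂ (inj₂ a∩b=∅) , _) = a∩b=∅
    J⊆⋃M : J ⊆ ⋃ M
    J⊆⋃M x∈J with cover x∈J
    ... | I , I∈N , x∈I , I⊆J with below-top I∈N I⊆J
    ...   | I* , I*∈N , top , I⊆I* = ∈-⋃⁺ (∈-filter⁺ isTop? I*∈N top) (I⊆I* x∈I)
    conclude : ∀ M′ → M′ ⊑ N → AllPairs Disjoint M′ → ⋃ M′ ≡ J → J ∈ˡ N
    conclude []           _ _    ⋃≡J with nonempty J J∈B
    ... | x , x∈J = ⊥-elim (∉⊥ (subst (x ∈_) (sym ⋃≡J) x∈J))
    conclude (I ∷ [])     s _    ⋃≡J = subst (_∈ˡ N) (trans (sym (∪-identityʳ I)) ⋃≡J) (Any-resp-⊆ s (here refl))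
    conclude (_ ∷ _ ∷ _)  s disj ⋃≡J = ⊥-elim (noUnion s (s≤s (s≤s z≤n)) disj (subst (_∈ᶠ B) (sym ⋃≡J) J∈B))

  top-has-private-point : ∀ {N I*} → All (_∈ᶠ B) N → Unique N → IsNested N → (I*∈N : I* ∈ˡ N) →
    (∀ {K} → K ∈ˡ N → ¬ I* ⊂ K) → ∃ λ x → x ∈ I* × x ∉ ⋃ (N ─ I*∈N)
  top-has-private-point {N} {I*} N⊆B unique nested I*∈N top
    with any? (λ x → (x ∈? I*) ×-dec ¬? (x ∈? ⋃ (N ─ I*∈N)))
  ... | yes private-point = private-point
  ... | no  no-private    = ⊥-elim (unique-─ N I*∈N unique
          (covered⇒∈ (AllPairs-resp-⊑ N′⊑N unique) (isNested-⊑ N′⊑N nested) (All.lookup N⊆B I*∈N) cover))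
    where
    N′⊑N : (N ─ I*∈N) ⊑ N
    N′⊑N = ─-⊑ N I*∈N
    cover : ∀ {x} → x ∈ I* → ∃ λ I → I ∈ˡ (N ─ I*∈N) × x ∈ I × I ⊆ I*
    cover {x} x∈I* with ∈-⋃⁻ (N ─ I*∈N) (decidable-stable (x ∈? ⋃ (N ─ I*∈N)) λ x∉ → no-private (x , x∈I* , x∉))
    ... | I , I∈N′ , x∈I =
      I , I∈N′ , x∈I ,
      below (Sum.[ id , nestedOrDisjoint-sym ] (AllPairs-≢ (proj₁ nested) (Any-resp-⊆ N′⊑N I∈N′) I*∈N I≢I*))
      where
      I≢I* : ¬ I ≡ I*
      I≢I* refl = unique-─ N I*∈N unique I∈N′
      below : NestedOrDisjoint I I* → I ⊆ I*
      below (inj₁ I⊆I*)          = I⊆I*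
      below (inj₂ (inj₁ I*⊆I))   = ⊥-elim (top (Any-resp-⊆ N′⊑N I∈N′) (⊆∧≢⇒⊂ I*⊆I (I≢I* ∘ sym)))
      below (inj₂ (inj₂ I∩I*=∅)) = ⊥-elim (I∩I*=∅ (x , x∈p∩q⁺ (x∈I , x∈I*)))

  length≤∣⋃∣ : ∀ {N} → All (_∈ᶠ B) N → Unique N → IsNested N → length N ≤ ∣ ⋃ N ∣
  length≤∣⋃∣ {N} = bounded (length N) ≤-refl
    where
    bounded : ∀ k {N} → length N ≤ k → All (_∈ᶠ B) N → Unique N → IsNested N → length N ≤ ∣ ⋃ N ∣
    bounded _ {[]} _ _ _ _ = z≤n
    bounded (suc k) {N@(_ ∷ _)} (s≤s ∣N∣≤1+k) N⊆B unique nested with Tops.below-top N ⊤ (here refl) ⊆⊤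
    ... | I* , I*∈N , (_ , top) , _
      with top-has-private-point N⊆B unique nested I*∈N (λ K∈N I*⊂K → All.lookup top K∈N (⊆⊤ , I*⊂K))
    ... | x , x∈I* , x∉⋃N′ = begin
        length N
      ≡⟨ length-─ N I*∈N ⟩
        suc (length (N ─ I*∈N))
      ≤⟨ s≤s (bounded k (≤-trans (≤-reflexive (sym (suc-injective (length-─ N I*∈N)))) ∣N∣≤1+k)
                      (All-resp-⊆ N′⊑N N⊆B) (AllPairs-resp-⊑ N′⊑N unique) (isNested-⊑ N′⊑N nested)) ⟩
        suc ∣ ⋃ (N ─ I*∈N) ∣
      ≤⟨ p⊂q⇒∣p∣<∣q∣ (⋃-⊆ (N ─ I*∈N) (All.map (λ I∈N {_} → ∈-⋃⁺ I∈N) (All.tabulate (Any-resp-⊆ N′⊑N))) ,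
                     x , ∈-⋃⁺ I*∈N x∈I* , x∉⋃N′) ⟩
        ∣ ⋃ N ∣
      ∎
      where
      open ≤-Reasoning
      N′⊑N : (N ─ I*∈N) ⊑ N
      N′⊑N = ─-⊑ N I*∈N

module Restrict {n : ℕ} (B : Family n) (S : Subset n) where

  restrict⇒ : ∀ {J} → J ∈ᶠ restrict B S → J ∈ᶠ B × J ⊆ S
  restrict⇒ {J} t = Product.map₂ (does⇒ (J ⊆? S)) (to T-∧ t)

  restrict⇐ : ∀ {J} → J ∈ᶠ B → J ⊆ S → J ∈ᶠ restrict B S
  restrict⇐ {J} J∈B J⊆S = from T-∧ (J∈B , does⇐ (J ⊆? S) J⊆S)

  restrict-isUnionClosed : IsUnionClosed B → IsUnionClosed (restrict B S)
  restrict-isUnionClosed uc = record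
    { nonempty = λ I → nonempty I ∘ proj₁ ∘ restrict⇒
    ; union    = λ I J I∈ J∈ meet →
        let (I∈B , I⊆S) = restrict⇒ I∈; (J∈B , J⊆S) = restrict⇒ J∈ in
        restrict⇐ (union I J I∈B J∈B meet) (Sum.[ I⊆S , J⊆S ] ∘ x∈p∪q⁻ I J)
    }
    where open IsUnionClosed uc

module _ {n : ℕ} (X : Family n) where

  members : List (Subset n)
  members = filterᵇ X (allSubsets n)

  members-unique : Unique members
  members-unique = Unique.filter⁺ (T? ∘ X) (allSubsets-unique n)

  members-∈ : All (_∈ᶠ X) members
  members-∈ = All.all-filter (T? ∘ X) (allSubsets n)

  ∈-members : ∀ {J} → J ∈ᶠ X → J ∈ˡ members
  ∈-members {J} = ∈-filter⁺ (T? ∘ X) (∈-allSubsets J)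

  nonMax-members : nonMax X ≡ filterᵇ (not ∘ isMaxᵇ X) members
  nonMax-members = sym (filterᵇ-filterᵇ (not ∘ isMaxᵇ X) X (allSubsets n))

  numMax-members : numMax X ≡ count (isMaxᵇ X) members
  numMax-members = sym (count-filterᵇ-⇒ (isMaxᵇ X) X (allSubsets n) (proj₁ ∘ to T-∧))

nestedSum : ∀ {n} → Family n → (ℕ → ℕ) → ℕ
nestedSum X = sublistSum (nonMax X) (isNestedᵇ X)

fN-lengthGF : ∀ {n} (X : Family n) → IsLengthGF (nonMax X) (isNestedᵇ X) (fN X)
coeff (fN-lengthGF X) k = trans (count-filterᵇ (λ N → length N ≡ᵇ k) (isNestedᵇ X) (sublists (nonMax X)))
                                (sym (sublistSum-sublists (nonMax X) (isNestedᵇ X) (δ k)))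

fP-reversedGF : ∀ {n} (X : Family n) S → IsReversedGF (nonMax X) (isNestedᵇ X) (∣ S ∣ ∸ numMax X) (fP X S)
coeff (fP-reversedGF X S) i with i ≤ᵇ (∣ S ∣ ∸ numMax X) in e
... | true  = trans (coeff (fN-lengthGF X) _) (sublistSum-congʷ (nonMax X) (isNestedᵇ X) λ {N} _ _ →
                δ-+ (length N) (≤ᵇ⇒≤ i _ (subst T (sym e) tt)))
... | false = sym (sublistSum-zero (nonMax X) (isNestedᵇ X) _ λ {N} _ _ →
                𝟙-≡ᵇ-≢ λ e′ → subst T e (≤⇒≤ᵇ (subst (i ≤_) e′ (m≤n+m i (length N)))))

-- The length bounds are read off the weighted identities at the weight a ↦ [a > b].
exceeds : ℕ → ℕ → ℕ
exceeds b a = 𝟙 (b <ᵇ a)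

exceeds-≤ : ∀ {a b} → a ≤ b → exceeds b a ≡ 0
exceeds-≤ {a} {b} a≤b with b <ᵇ a in e
... | true  = ⊥-elim (<⇒≱ (<ᵇ⇒< b a (subst T (sym e) tt)) a≤b)
... | false = refl

exceeds≡0⇒ : ∀ {a b} → exceeds b a ≡ 0 → a ≤ b
exceeds≡0⇒ {a} {b} e with b <ᵇ a in e′ | ≤-<-connex a b
... | _     | inj₁ a≤b = a≤b
... | false | inj₂ b<a = ⊥-elim (subst T e′ (<⇒<ᵇ b<a))

module BuildingSet {n : ℕ} {B : Family n} (isBuildingSet : IsBuildingSet B) where

  open IsBuildingSet isBuildingSet

  isUnionClosed : IsUnionClosed B
  isUnionClosed = record { nonempty = nonempty ; union = union }

  module InB = UnionClosed B isUnionClosed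
  module MaxB = Marked _≟ˢ_ (isMaxᵇ B) (_∈ᶠ B)

  nested-length≤ : ∀ {N} → N ⊑ members B → T (isNestedᵇ B N) → length N ≤ ∣ ⋃ N ∣
  nested-length≤ s t =
    InB.length≤∣⋃∣ (All-resp-⊆ s (members-∈ B)) (AllPairs-resp-⊑ s (members-unique B)) (InB.isNestedᵇ⇒ _ t)

  sublistSum-members : ∀ ℓ →
    sublistSum (members B) (isNestedᵇ B) ℓ ≡ nestedSum B (stepSum (numMax B) ℓ)
  sublistSum-members ℓ =
    trans (MaxB.sublistSum-ignoresMarked (members B) (isNestedᵇ B) ℓ (members-∈ B)
             (λ N₁ N₂ y → InB.isNested-insertMaximal N₁ N₂ ∘ InB.isMaxᵇ⇒))
          (cong₂ (λ L c → sublistSum L (isNestedᵇ B) (stepSum c ℓ)) (sym (nonMax-members B)) (sym (numMax-members B)))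

  module Restriction (S : Subset n) where

    R : Family n
    R = restrict B S

    open Restrict B S

    module InR  = UnionClosed R (restrict-isUnionClosed isUnionClosed)
    module MaxR = Marked _≟ˢ_ (isMaxᵇ R) (_∈ᶠ R)

    maximal-exists : ∀ {x} → x ∈ S → ∃ λ J → InR.IsMaximal J × x ∈ J
    maximal-exists {x} x∈S with Tops.below-top (members R) ⊤ (∈-members R ⁅x⁆∈R) ⊆⊤
      where
      ⁅x⁆∈R : ⁅ x ⁆ ∈ᶠ R
      ⁅x⁆∈R = restrict⇐ (singleton x) (λ y∈⁅x⁆ → subst (_∈ S) (sym (x∈⁅y⁆⇒x≡y x y∈⁅x⁆)) x∈S)
    ... | J , J∈R , (_ , top) , ⁅x⁆⊆J =
      J , (All.lookup (members-∈ R) J∈R , λ K K∈R J⊂K → All.lookup top (∈-members R K∈R) (⊆⊤ , J⊂K)) , ⁅x⁆⊆J (x∈⁅x⁆ x)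

    isNested-restrict : ∀ {N} → All (_⊆ S) N → isNestedᵇ B N ≡ isNestedᵇ R N
    isNested-restrict {N} N⊆S = T-ext
      (InR.isNestedᵇ⇐ N ∘ Product.map₂ (λ noUnion {M} s 2≤ disj → noUnion s 2≤ disj ∘ proj₁ ∘ restrict⇒) ∘ InB.isNestedᵇ⇒ N)
      (InB.isNestedᵇ⇐ N ∘ Product.map₂ (λ noUnion {M} s 2≤ disj →
         noUnion s 2≤ disj ∘ flip restrict⇐ (⋃-⊆ M (All-resp-⊆ s N⊆S))) ∘ InR.isNestedᵇ⇒ N)

    covers⇔containsMaximal : ∀ {N} → N ⊑ members R →
      (isNestedᵇ B N ∧ does (⋃ N ≟ˢ S)) ≡ (isNestedᵇ R N ∧ MaxR.containsMarked (members R) N)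
    covers⇔containsMaximal {N} s = T-ext forth back
      where
      N⊆R : All (_∈ᶠ R) N
      N⊆R = All-resp-⊆ s (members-∈ R)
      N⊆S : All (_⊆ S) N
      N⊆S = All.map (λ I∈R {_} → proj₂ (restrict⇒ I∈R)) N⊆R
      maximal-∈ : InB.IsNested N → ⋃ N ≡ S → ∀ {y} → InR.IsMaximal y → y ∈ˡ N
      maximal-∈ nested ⋃N≡S {y} max@(y∈R , _) =
        InB.covered⇒∈ (AllPairs-resp-⊑ s (members-unique R)) nested (proj₁ (restrict⇒ y∈R)) cover
        where
        cover : ∀ {x} → x ∈ y → ∃ λ I → I ∈ˡ N × x ∈ I × I ⊆ y
        cover {x} x∈y with ∈-⋃⁻ N (subst (x ∈_) (sym ⋃N≡S) (proj₂ (restrict⇒ y∈R) x∈y))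
        ... | I , I∈N , x∈I = I , I∈N , x∈I , InR.maximal-absorbs max (All.lookup N⊆R I∈N) (x , x∈p∩q⁺ (x∈I , x∈y))
      S⊆⋃N : T (MaxR.containsMarked (members R) N) → S ⊆ ⋃ N
      S⊆⋃N contains x∈S with maximal-exists x∈S
      ... | J , max , x∈J =
        ∈-⋃⁺ {N = N} (All.lookup (MaxR.containsMarked⁻ (members R) {N} contains) (∈-members R (proj₁ max))
                                  (InR.isMaxᵇ⇐ max)) x∈J
      forth : T (isNestedᵇ B N ∧ does (⋃ N ≟ˢ S)) → T (isNestedᵇ R N ∧ MaxR.containsMarked (members R) N)
      forth t with to T-∧ t
      ... | nested , covers = from T-∧ (subst T (isNested-restrict N⊆S) nested ,
        MaxR.containsMarked⁺ (members R) (All.tabulate λ _ →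
          maximal-∈ (InB.isNestedᵇ⇒ N nested) (does⇒ (⋃ N ≟ˢ S) covers) ∘ InR.isMaxᵇ⇒))
      back : T (isNestedᵇ R N ∧ MaxR.containsMarked (members R) N) → T (isNestedᵇ B N ∧ does (⋃ N ≟ˢ S))
      back t with to T-∧ t
      ... | nested , contains =
        from T-∧ (subst T (sym (isNested-restrict N⊆S)) nested ,
                  does⇐ (⋃ N ≟ˢ S) (⊆-antisym (⋃-⊆ N N⊆S) (S⊆⋃N contains)))

    sublistSum-⋃≡ : ∀ ℓ → sublistSum (members B) (λ N → isNestedᵇ B N ∧ does (⋃ N ≟ˢ S)) ℓ ≡
                          nestedSum R (λ a → ℓ (a + numMax R))
    sublistSum-⋃≡ ℓ = begin
        sublistSum (members B) covers ℓ
      ≡⟨ sublistSum-filter (_⊆ᵇ S) (members B) covers ℓ inside-S ⟩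
        sublistSum (filterᵇ (_⊆ᵇ S) (members B)) covers ℓ
      ≡⟨ cong (λ L → sublistSum L covers ℓ) (filterᵇ-filterᵇ (_⊆ᵇ S) B (allSubsets n)) ⟩
        sublistSum (members R) covers ℓ
      ≡⟨ sublistSum-congᴾ (members R) ℓ covers⇔containsMaximal ⟩
        sublistSum (members R) (λ N → isNestedᵇ R N ∧ MaxR.containsMarked (members R) N) ℓ
      ≡⟨ MaxR.sublistSum-containsMarked (members R) (isNestedᵇ R) ℓ (members-∈ R) (members-unique R)
           (λ N₁ N₂ y → InR.isNested-insertMaximal N₁ N₂ ∘ InR.isMaxᵇ⇒) ⟩
        sublistSum (MaxR.unmarked (members R)) (isNestedᵇ R) (λ a → ℓ (a + count (isMaxᵇ R) (members R)))
      ≡⟨ cong₂ (λ L c → sublistSum L (isNestedᵇ R) (λ a → ℓ (a + c)))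
               (sym (nonMax-members R)) (sym (numMax-members R)) ⟩
        nestedSum R (λ a → ℓ (a + numMax R))
      ∎
      where
      open ≡-Reasoning
      covers : List (Subset n) → Bool
      covers N = isNestedᵇ B N ∧ does (⋃ N ≟ˢ S)
      inside-S : ∀ {N} → T (covers N) → All (T ∘ (_⊆ᵇ S)) N
      inside-S {N} t = All.tabulate λ {I} I∈N → does⇐ (I ⊆? S) λ x∈I →
        subst (_ ∈_) (does⇒ (⋃ N ≟ˢ S) (proj₂ (to (T-∧ {isNestedᵇ B N}) t))) (∈-⋃⁺ I∈N x∈I)

    length+numMax≤∣S∣ : ∀ {N} → N ⊑ nonMax R → T (isNestedᵇ R N) → length N + numMax R ≤ ∣ S ∣
    length+numMax≤∣S∣ s t = exceeds≡0⇒ (sublistSum≡0⇒ (nonMax R) (isNestedᵇ R) _ none-exceed s t)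
      where
      none-exceed : nestedSum R (λ a → exceeds ∣ S ∣ (a + numMax R)) ≡ 0
      none-exceed = trans (sym (sublistSum-⋃≡ (exceeds ∣ S ∣))) (sublistSum-zero (members B) _ _ λ {N} s t →
        let (nested , covers) = to T-∧ t in
        exceeds-≤ (subst (λ X → length N ≤ ∣ X ∣) (does⇒ (⋃ N ≟ˢ S) covers) (nested-length≤ s nested)))

    numMax≤∣S∣ : numMax R ≤ ∣ S ∣
    numMax≤∣S∣ = length+numMax≤∣S∣ (minimum _) tt

    fP-*ₚ-tpow : ∀ i → (fP R S *ₚ tpow (n ∸ ∣ S ∣)) i ≡ nestedSum R (λ a → δ n (a + numMax R + i))
    fP-*ₚ-tpow i = trans
      (reversedGF-*ₚ-tpow (fP-reversedGF R S) (λ s t → m+n≤o⇒m≤o∸n _ (length+numMax≤∣S∣ s t)) (n ∸ ∣ S ∣) i)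
      (sublistSum-congʷ (nonMax R) (isNestedᵇ R) λ {N} _ _ → 𝟙-≡ᵇ-cong (forth (length N)) (back (length N)))
      where
      μ x y : ℕ
      μ = numMax R
      x = ∣ S ∣ ∸ μ
      y = n ∸ ∣ S ∣
      n≡ : x + y + μ ≡ n
      n≡ = trans (+-rearrange x y μ) (trans (cong (y +_) (m∸n+n≡m numMax≤∣S∣)) (m∸n+n≡m (∣p∣≤n S)))
      forth : ∀ a → a + i ≡ x + y → a + μ + i ≡ n
      forth a e = trans (+-swapʳ a μ i) (trans (cong (_+ μ) e) n≡)
      back : ∀ a → a + μ + i ≡ n → a + i ≡ x + y
      back a e = +-cancelʳ-≡ μ _ _ (trans (sym (+-swapʳ a μ i)) (trans e (sym n≡)))

  length+numMax≤n : ∀ {N} → N ⊑ nonMax B → T (isNestedᵇ B N) → length N + numMax B ≤ n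
  length+numMax≤n {N} s t = subst (_≤ n) (+-comm (numMax B) (length N)) (exceeds≡0⇒ (n≤0⇒n≡0
    (subst (exceeds n (numMax B + length N) ≤_) (sublistSum≡0⇒ (nonMax B) (isNestedᵇ B) _ none-exceed s t)
           (stepSum-≥ (numMax B) (exceeds n) (length N)))))
    where
    none-exceed : nestedSum B (stepSum (numMax B) (exceeds n)) ≡ 0
    none-exceed = trans (sym (sublistSum-members (exceeds n))) (sublistSum-zero (members B) _ _ λ {N} s t →
      exceeds-≤ (≤-trans (nested-length≤ s t) (∣p∣≤n (⋃ N))))

  nested-decomposition : ∀ ℓ → nestedSum B (stepSum (numMax B) ℓ) ≡
    sumOver (allSubsets n) (λ S → nestedSum (restrict B S) (λ a → ℓ (a + numMax (restrict B S))))
  nested-decomposition ℓ = begin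
      nestedSum B (stepSum (numMax B) ℓ)
    ≡⟨ sublistSum-members ℓ ⟨
      sublistSum (members B) (isNestedᵇ B) ℓ
    ≡⟨ sublistSum-partition _≟ˢ_ (allSubsets-unique n) ∈-allSubsets ⋃ (members B) (isNestedᵇ B) ℓ ⟩
      sumOver (allSubsets n) (λ S → sublistSum (members B) (λ N → isNestedᵇ B N ∧ does (⋃ N ≟ˢ S)) ℓ)
    ≡⟨ sumOver-cong (allSubsets n) (λ S → Restriction.sublistSum-⋃≡ S ℓ) ⟩
      sumOver (allSubsets n) (λ S → nestedSum (restrict B S) (λ a → ℓ (a + numMax (restrict B S))))
    ∎
    where open ≡-Reasoning

  fP-*ₚ-[t+1]^ : ∀ i →
    (fP B ⊤ *ₚ (t+1 ^ₚ numMax B)) i ≡ nestedSum B (stepSum (numMax B) (λ a → δ n (a + i)))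
  fP-*ₚ-[t+1]^ i = trans
    (reversedGF-*ₚ-[t+1]^ (fP-reversedGF B ⊤) bound (numMax B) i)
    (cong (λ D → nestedSum B (stepSum (numMax B) (λ a → δ D (a + i))))
          (trans (cong (λ s → s ∸ numMax B + numMax B) (∣⊤∣≡n n))
                 (m∸n+n≡m (m+n≤o⇒n≤o 0 (length+numMax≤n (minimum _) tt)))))
    where
    bound : ∀ {N} → N ⊑ nonMax B → T (isNestedᵇ B N) → length N ≤ ∣ ⊤ {n} ∣ ∸ numMax B
    bound {N} s t = subst (λ s → length N ≤ s ∸ numMax B) (sym (∣⊤∣≡n n)) (m+n≤o⇒m≤o∸n (length N) (length+numMax≤n s t))

proposition5p3 : (n : ℕ) (B : Family n) → IsBuildingSet B →
    ((fN B *ₚ (t+1 ^ₚ numMax B))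
      ≈ₚ Σₚ (allSubsets n) (λ S → tpow (numMax (restrict B S)) *ₚ fN (restrict B S)))
    ×
    ((fP B ⊤ *ₚ (t+1 ^ₚ numMax B))
      ≈ₚ Σₚ (allSubsets n) (λ S → fP (restrict B S) S *ₚ tpow (n ∸ ∣ S ∣)))
proposition5p3 n B isBuildingSet = fN-identity , fP-identity
  where
  open BuildingSet isBuildingSet
  open ≡-Reasoning
  μ : Subset n → ℕ
  μ S = numMax (restrict B S)
  fN-identity : (fN B *ₚ (t+1 ^ₚ numMax B)) ≈ₚ Σₚ (allSubsets n) (λ S → tpow (μ S) *ₚ fN (restrict B S))
  fN-identity k = begin
      (fN B *ₚ (t+1 ^ₚ numMax B)) k
    ≡⟨ lengthGF-*ₚ-[t+1]^ (fN-lengthGF B) (numMax B) k ⟩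
      nestedSum B (stepSum (numMax B) (δ k))
    ≡⟨ nested-decomposition (δ k) ⟩
      sumOver (allSubsets n) (λ S → nestedSum (restrict B S) (λ a → δ k (a + μ S)))
    ≡⟨ sumOver-cong (allSubsets n) (λ S → tpow-*ₚ-lengthGF (fN-lengthGF (restrict B S)) (μ S) k) ⟨
      sumOver (allSubsets n) (λ S → (tpow (μ S) *ₚ fN (restrict B S)) k)
    ≡⟨ Σₚ-apply (allSubsets n) (λ S → tpow (μ S) *ₚ fN (restrict B S)) k ⟨
      Σₚ (allSubsets n) (λ S → tpow (μ S) *ₚ fN (restrict B S)) k
    ∎
  fP-identity : (fP B ⊤ *ₚ (t+1 ^ₚ numMax B)) ≈ₚ Σₚ (allSubsets n) (λ S → fP (restrict B S) S *ₚ tpow (n ∸ ∣ S ∣))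
  fP-identity i = begin
      (fP B ⊤ *ₚ (t+1 ^ₚ numMax B)) i
    ≡⟨ fP-*ₚ-[t+1]^ i ⟩
      nestedSum B (stepSum (numMax B) (λ a → δ n (a + i)))
    ≡⟨ nested-decomposition (λ a → δ n (a + i)) ⟩
      sumOver (allSubsets n) (λ S → nestedSum (restrict B S) (λ a → δ n (a + μ S + i)))
    ≡⟨ sumOver-cong (allSubsets n) (λ S → Restriction.fP-*ₚ-tpow S i) ⟨
      sumOver (allSubsets n) (λ S → (fP (restrict B S) S *ₚ tpow (n ∸ ∣ S ∣)) i)
    ≡⟨ Σₚ-apply (allSubsets n) (λ S → fP (restrict B S) S *ₚ tpow (n ∸ ∣ S ∣)) i ⟨
      Σₚ (allSubsets n) (λ S → fP (restrict B S) S *ₚ tpow (n ∸ ∣ S ∣)) i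
    ∎
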